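{- Let $\zeta:\mathbf{W}\to\mathbb{k}$ be a linear map with $\zeta([\emptyset,n])=1$ for all $n\in\mathbb{N}$ and $\zeta\circ\nabla_{\mathrm{sh}}=\nabla_{\mathbb{k}}\circ(\zeta\otimes\zeta)$. Then the linear map $\Psi:\mathbf{W}\to\mathsf{QSym}$ given by $$\Psi(x)=\sum_{\alpha}\zeta_\alpha(x)M_\alpha,$$ the sum over all compositions $\alpha$, is the unique morphism of combinatorial bialgebras $(\mathbf{W},\zeta)\to(\mathsf{QSym},\zeta_{\mathsf{QSym}})$, and its restriction to $\mathbf{\Pi}$ is the unique morphism of combinatorial bialgebras $(\mathbf{\Pi},\zeta|_{\mathbf{\Pi}})\to(\mathsf{QSym},\zeta_{\mathsf{QSym}})$.
   Context: Fix a field $\mathbb{k}$. A word is a finite sequence of positive integers; $\ell(w)$ is its length. $\mathbf{W}$ is the graded $\mathbb{k}$-bialgebra with basis symbols $[w,n]$ ($n\in\mathbb{N}$, $w$ a word with all letters $\le n$), $[w,n]$ of degree $\ell(w)$, product $\nabla_{\mathrm{sh}}([v,m]\otimes[w,n])=\sum_u[u,m+n]$ (sum with multiplicity over all shuffles $u$ of $v$ with $w\uparrow m$, the word obtained by adding $m$ to each letter of $w$), unit $[\emptyset,0]$, coproduct $\Delta_\odot([w_1\cdots w_k,n])=\sum_{i=0}^k[w_1\cdots w_i,n]\otimes[w_{i+1}\cdots w_k,n]$ and counit $\epsilon_\odot([w,n])=1$ if $w=\emptyset$, else $0$. $S_n$ is the symmetric group, $s_i=(i,i+1)$, $\mathcal{R}(\pi)$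 the set of reduced words; for $\pi\in S_{n+1}$, $[\pi]=\sum_{w\in\mathcal{R}(\pi)}[w,n]$, and $\mathbf{\Pi}=\operatorname{span}\{[\pi]\}$ is a graded sub-bialgebra of $\mathbf{W}$. For a composition $\alpha=(\alpha_1,\dots,\alpha_r)\neq\emptyset$, $\zeta_\alpha:\mathbf{W}\to\mathbb{k}$ is the composite $\nabla_{\mathbb{k}}^{(r-1)}\circ\zeta^{\otimes r}\circ(p_{\alpha_1}\otimes\cdots\otimes p_{\alpha_r})\circ\Delta_\odot^{(r-1)}$, where $p_d$ is the projection onto the degree-$d$ part; equivalently $\zeta_\alpha([w,n])=\prod_i\zeta([w^{(i)},n])$ if $w=w^{(1)}\cdots w^{(r)}$ with $\ell(w^{(i)})=\alpha_i$, and $0$ if $\alpha$ is not a composition of $\ell(w)$; and $\zeta_\emptyset=\epsilon_\odot$. $\mathsf{QSym}\subseteq\mathbb{k}[[x_1,x_2,\dots]]$ is the graded Hopf algebra of quasi-symmetric functions with basis the monomial quasi-symmetric functions $M_\alpha=\sum_{i_1<\cdots<i_r}x_{i_1}^{\alpha_1}\cdots x_{i_r}^{\alpha_r}$ ($M_\emptyset=1$), coproduct $\Delta(M_\alpha)=\sum_{\alpha=\beta\gamma}M_\beta\otimes M_\gamma$ (concatenations) and counit $M_\alpha\mapsto\delta_{\alpha,\emptyset}$; $\zeta_{\mathsf{QSym}}:\mathsf{QSym}\to\mathbb{k}$ sets $x_1=1$ and $x_i=0$ for $i\ge2$. A combinatorial coalgebra is a pair $(A,\xi)$ of a graded coalgebra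 $A$ and a linear map $\xi:A\to\mathbb{k}$ agreeing with the counit on degree-zero elements; a morphism $(A,\xi)\to(A',\xi')$ is a graded coalgebra morphism $\Phi$ with $\xi=\xi'\circ\Phi$. A combinatorial bialgebra is a combinatorial coalgebra $(A,\xi)$ in which $A$ is a graded bialgebra and $\xi$ is an algebra morphism; morphisms of combinatorial bialgebras are morphisms of combinatorial coalgebras which are bialgebra morphisms. -}

module Defs where

open import Level using (Level; _⊔_) renaming (suc to lsuc)
open import Algebra.Bundles using (CommutativeRing)
open import Data.Nat as ℕ using (ℕ; zero; suc; _≤ᵇ_; _≟_)
open import Data.Nat.ListAction using (sum)
open import Data.Fin as Fin using (Fin; inject₁; _↑ˡ_; _↑ʳ_; _<?_)
open import Data.Fin.Permutation using (Permutation′; _⟨$⟩ʳ_; transpose)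
open import Data.Fin.Properties using (all?)
open import Data.List using (List; []; _∷_; map; concatMap; _++_; length; take; drop; filter; upTo; allFin; foldr)
import Data.List.Properties as LP
import Data.Product.Properties as PP
open import Data.Product using (Σ; _×_; _,_; ∃; proj₁; proj₂)
open import Relation.Nullary.Decidable using (_×-dec_)
open import Data.Bool using (Bool; true; false; if_then_else_)
open import Relation.Nullary using (¬_; does)
open import Relation.Binary.PropositionalEquality using (_≡_)
open import Relation.Binary.Definitions using (DecidableEquality)

record Field (c ℓ : Level) : Set (lsuc (c ⊔ ℓ)) where
  field
    commutativeRing : CommutativeRing c ℓ
  open CommutativeRing commutativeRing public
  field
    0≉1     : ¬ (0# ≈ 1#)
    inverse : ∀ x → ¬ (x ≈ 0#) → Σ Carrier (λ y → x * y ≈ 1#)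

shuffles : {A : Set} → List A → List A → List (List A)
shuffles []       ys       = ys ∷ []
shuffles (x ∷ xs) []       = (x ∷ xs) ∷ []
shuffles (x ∷ xs) (y ∷ ys) =
  map (x ∷_) (shuffles xs (y ∷ ys)) ++ map (y ∷_) (shuffles (x ∷ xs) ys)

splits : {A : Set} → List A → List (List A × List A)
splits xs = map (λ i → take i xs , drop i xs) (upTo (suc (length xs)))

-- The basis symbol [w , n] is represented as (n , w) with
-- w : List (Fin n); the element i : Fin n stands for the letter i+1,
-- so words are exactly the words with all letters in {1,…,n}.
BW : Set
BW = Σ ℕ (λ n → List (Fin n))

_≟W_ : DecidableEquality BW
_≟W_ = PP.≡-dec _≟_ (LP.≡-dec Fin._≟_)

degW : BW → ℕ
degW (n , w) = length w

-- Compositions.  A composition (α₁,…,α_r) of positive integers is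
-- represented as the list (α₁ - 1 , … , α_r - 1) : List ℕ.
Comp : Set
Comp = List ℕ

_≟C_ : DecidableEquality Comp
_≟C_ = LP.≡-dec _≟_

∣_∣c : Comp → ℕ
∣ α ∣c = sum (map suc α)

compsSuc : ℕ → List Comp        -- compositions of (suc n)
compsSuc zero    = (0 ∷ []) ∷ []
compsSuc (suc n) = concatMap (λ α → (0 ∷ α) ∷ bump α) (compsSuc n)
  where
  bump : Comp → List Comp
  bump []      = []
  bump (h ∷ t) = (suc h ∷ t) ∷ []

comps : ℕ → List Comp
comps zero    = [] ∷ []
comps (suc n) = compsSuc n

-- quasi-shuffles (stuffles) of compositions, with multiplicity:
-- M_α M_β = Σ_{γ ∈ qshuffles α β} M_γ  (product of QSym in the M-basis).
-- Merged part: (a+1)+(b+1) = (a + suc b) + 1.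
qshuffles : Comp → Comp → List Comp
qshuffles []       β        = β ∷ []
qshuffles (a ∷ α)  []       = (a ∷ α) ∷ []
qshuffles (a ∷ α)  (b ∷ β)  =
  map (a ∷_) (qshuffles α (b ∷ β))
  ++ map (b ∷_) (qshuffles (a ∷ α) β)
  ++ map ((a ℕ.+ suc b) ∷_) (qshuffles α β)

-- Permutations in S_{n+1} act on Fin (suc n); the letter i : Fin n
-- (standing for i+1) denotes s_{i+1} = transposition of the elements
-- inject₁ i and suc i (i.e. of i+1 and i+2 in 1-based notation).
sgen : {n : ℕ} → Fin n → Permutation′ (suc n)
sgen i = transpose (inject₁ i) (Fin.suc i)

-- the product s_{w₁} s_{w₂} ⋯ s_{w_k}, as a function ((πσ)(x) = π(σ(x)))
wordPerm : {n : ℕ} → List (Fin n) → Fin (suc n) → Fin (suc n)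
wordPerm []      x = x
wordPerm (i ∷ w) x = sgen i ⟨$⟩ʳ wordPerm w x

-- number of inversions #{(i,j) : i < j, π(i) > π(j)}; this is the
-- Coxeter length ℓ(π), i.e. the common length of the reduced words of π
inv : {n : ℕ} → Permutation′ (suc n) → ℕ
inv {n} π = length (filter (λ ij → (proj₁ ij <? proj₂ ij) ×-dec (π ⟨$⟩ʳ proj₂ ij <? π ⟨$⟩ʳ proj₁ ij))
                           (concatMap (λ i → map (i ,_) (allFin (suc n))) (allFin (suc n))))

words : ℕ → (n : ℕ) → List (List (Fin n))
words zero    n = [] ∷ []
words (suc k) n = concatMap (λ i → map (i ∷_) (words k n)) (allFin n)

reducedWords : {n : ℕ} → Permutation′ (suc n) → List (List (Fin n))
reducedWords {n} π = filter (λ w → all? (λ x → wordPerm w x Fin.≟ π ⟨$⟩ʳ x)) (words (inv π) n)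

BΠ : Set
BΠ = Σ ℕ (λ n → Permutation′ (suc n))

degΠ : BΠ → ℕ
degΠ (n , π) = inv π

-- Vector spaces with a given basis B are represented by finite formal
-- linear combinations (List (𝕜 × B)); two combinations are equal when
-- all their coefficients agree.  A linear map out of such a space is
-- given by its values on the basis (and extended linearly).

module WithField {c ℓ} (𝕜 : Field c ℓ) where
  open Field 𝕜 public renaming (Carrier to K)

  FV : Set → Set c
  FV B = List (K × B)

  coeff : {B : Set} → DecidableEquality B → FV B → B → K
  coeff eq []             b = 0#
  coeff eq ((k , b') ∷ x) b = (if does (eq b' b) then k else 0#) + coeff eq x b

  EqV : {B : Set} → DecidableEquality B → FV B → FV B → Set ℓ
  EqV eq x y = ∀ b → coeff eq x b ≈ coeff eq y b

  lin : {B C : Set} → (B → FV C) → FV B → FV C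
  lin f x = concatMap (λ kb → map (λ lc → (proj₁ kb * proj₁ lc , proj₂ lc)) (f (proj₂ kb))) x

  linK : {B : Set} → (B → K) → FV B → K
  linK f x = foldr (λ kb r → proj₁ kb * f (proj₂ kb) + r) 0# x

  bilin : {B C : Set} → (B → B → FV C) → FV B → FV B → FV C
  bilin f x y = concatMap (λ kb → concatMap (λ lb → map (λ mc → (proj₁ kb * proj₁ lb * proj₁ mc , proj₂ mc)) (f (proj₂ kb) (proj₂ lb))) y) x

  -- tensor product f ⊗ g of linear maps, on the tensor product of the free
  -- spaces (the free space on the product of the bases)
  tens : {B B' C C' : Set} → (B → FV C) → (B' → FV C') → FV (B × B') → FV (C × C')
  tens f g = lin (λ bb → concatMap (λ kc → map (λ lc → (proj₁ kc * proj₁ lc , (proj₂ kc , proj₂ lc))) (g (proj₂ bb))) (f (proj₁ bb)))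

  _≈W_ : FV BW → FV BW → Set ℓ
  _≈W_ = EqV _≟W_

  _≈WW_ : FV (BW × BW) → FV (BW × BW) → Set ℓ
  _≈WW_ = EqV (PP.≡-dec _≟W_ _≟W_)

  unitW : FV BW
  unitW = (1# , (0 , [])) ∷ []

  prodW : BW → BW → FV BW
  prodW (m , v) (n , w) =
    map (λ u → (1# , (m ℕ.+ n , u))) (shuffles (map (_↑ˡ n) v) (map (m ↑ʳ_) w))

  ΔW : BW → FV (BW × BW)
  ΔW (n , w) = map (λ pq → (1# , ((n , proj₁ pq) , (n , proj₂ pq)))) (splits w)

  εW : BW → K
  εW (n , [])    = 1#
  εW (n , _ ∷ _) = 0#

  _≈Q_ : FV Comp → FV Comp → Set ℓ
  _≈Q_ = EqV _≟C_

  _≈QQ_ : FV (Comp × Comp) → FV (Comp × Comp) → Set ℓ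
  _≈QQ_ = EqV (PP.≡-dec _≟C_ _≟C_)

  unitQ : FV Comp
  unitQ = (1# , []) ∷ []

  prodQ : Comp → Comp → FV Comp
  prodQ α β = map (λ γ → (1# , γ)) (qshuffles α β)

  ΔQ : Comp → FV (Comp × Comp)
  ΔQ α = map (λ βγ → (1# , βγ)) (splits α)

  εQ : Comp → K
  εQ []      = 1#
  εQ (_ ∷ _) = 0#

  -- ζ_QSym(M_α) = M_α(1,0,0,…) = 1 if α has at most one part, else 0
  ζQ : Comp → K
  ζQ []          = 1#
  ζQ (_ ∷ [])    = 1#
  ζQ (_ ∷ _ ∷ _) = 0#

  zetaA : (BW → K) → Comp → BW → K
  zetaA ζ []      b       = εW b
  zetaA ζ (a ∷ α) (n , w) =
    if suc a ≤ᵇ length w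
    then ζ (n , take (suc a) w) * zetaA ζ α (n , drop (suc a) w)
    else 0#

  -- Ψ(x) = Σ_α ζ_α(x) M_α ; on a basis element [w,n] only compositions of
  -- ℓ(w) can contribute (ζ_α vanishes otherwise), so the sum is over those.
  Ψ : (BW → K) → BW → FV Comp
  Ψ ζ b = map (λ α → (zetaA ζ α b , α)) (comps (degW b))

  ι : BΠ → FV BW
  ι (n , π) = map (λ w → (1# , (n , w))) (reducedWords π)

  Ψres : (BW → K) → BΠ → FV Comp
  Ψres ζ p = lin (Ψ ζ) (ι p)

  Multiplicative : (BW → K) → Set ℓ
  Multiplicative ζ = ∀ b b' → linK ζ (prodW b b') ≈ ζ b * ζ b'

  record IsCombBialgMorW (ζ : BW → K) (Φ : BW → FV Comp) : Set ℓ where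
    field
      graded     : ∀ b α → ¬ (∣ α ∣c ≡ degW b) → coeff _≟C_ (Φ b) α ≈ 0#
      comult     : ∀ b → tens Φ Φ (ΔW b) ≈QQ lin ΔQ (Φ b)
      counit     : ∀ b → linK εQ (Φ b) ≈ εW b
      unit       : lin Φ unitW ≈Q unitQ
      mult       : ∀ b b' → lin Φ (prodW b b') ≈Q bilin prodQ (Φ b) (Φ b')
      compatible : ∀ b → linK ζQ (Φ b) ≈ ζ b

  -- The bialgebra operations of Π are
  -- those of W restricted to Π (a sub-bialgebra); an element y of Π (resp.
  -- Π ⊗ Π), given in the basis [π] (resp. [σ] ⊗ [τ]), is identified with
  -- its image ι y in W (resp. (ι ⊗ ι) y in W ⊗ W), ι being injective.
  record IsCombBialgMorΠ (ζ : BW → K) (Φ : BΠ → FV Comp) : Set (c ⊔ ℓ) where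
    field
      graded     : ∀ p α → ¬ (∣ α ∣c ≡ degΠ p) → coeff _≟C_ (Φ p) α ≈ 0#
      comult     : ∀ p (y : FV (BΠ × BΠ)) → tens ι ι y ≈WW lin ΔW (ι p) →
                   tens Φ Φ y ≈QQ lin ΔQ (Φ p)
      counit     : ∀ p → linK εQ (Φ p) ≈ linK εW (ι p)
      unit       : ∀ (y : FV BΠ) → lin ι y ≈W unitW → lin Φ y ≈Q unitQ
      mult       : ∀ p q (y : FV BΠ) → lin ι y ≈W bilin prodW (ι p) (ι q) →
                   lin Φ y ≈Q bilin prodQ (Φ p) (Φ q)
      compatible : ∀ p → linK ζQ (Φ p) ≈ linK ζ (ι p)

-- Since ζ_{βγ} is the convolution of ζ_β and ζ_γ along
-- deconcatenation, Ψ is a coalgebra map, and ζ_QSym reads off the coefficient of M_(ℓ(w)), which is ζ.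
-- For multiplicativity, the prefix of length t of a shuffle of v and w↑m is a shuffle of prefixes of
-- lengths i + j = t; multiplicativity of ζ then turns ζ_γ of a shuffle product into the sum over the
-- quasi-shuffles producing γ, which is the M_γ-coefficient of Ψ[v,m] Ψ[w,n].
-- Conversely, in a coalgebra map Φ compatible with ζ the coefficient of M_∅ is fixed by the counit,
-- that of M_(a) by grading and ζ, and that of M_(a)β by the coproduct and induction on β.
-- On Π the same argument applies because Δ[π] ∈ Π ⊗ Π: both factors of a reduced word are reduced,
-- as the Coxeter length (counted by inversions) is subadditive and bounded by word length, so
-- Δ[π] = Σ [σ] ⊗ [τ] over the factorisations π = στ with ℓ(σ) + ℓ(τ) = ℓ(π).

module Submission where

open import Defs
open import Level using (Level; 0ℓ)
import Algebra.Properties.CommutativeSemigroup as CommSemigroupProps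
import Algebra.Properties.Ring as RingProps
import Algebra.Properties.Semiring.Sum as SemiringSum
open import Function using (_∘_)
open import Data.Bool using (Bool; true; false; if_then_else_; _∧_; T)
open import Data.Empty using (⊥; ⊥-elim)
open import Data.Fin as F using (Fin; zero; suc; inject₁; toℕ; _<?_; _↑ˡ_; _↑ʳ_)
import Data.Fin.Properties as FP
open import Data.Fin.Permutation as Perm using (Permutation′; _⟨$⟩ʳ_; _∘ₚ_)
import Data.Fin.Permutation.Components as PC
open import Data.List using (List; []; _∷_; map; concatMap; _++_; length; filter; foldr; take; drop; tabulate; allFin; applyUpTo)
import Data.List.Properties as LP
open import Data.List.Membership.Propositional using (_∈_)
import Data.List.Membership.Propositional.Properties as MP
open import Data.List.Relation.Unary.All as All using (All; []; _∷_)
import Data.List.Relation.Unary.All.Properties as AllP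
import Data.List.Relation.Unary.Any as Any
open import Data.Nat as ℕ using (ℕ; zero; suc; z≤n; s≤s; _≤ᵇ_)
import Data.Nat.Properties as NP
open import Data.Product using (_×_; _,_; proj₁; proj₂)
import Data.Product.Properties as PP
open import Data.Sum using (_⊎_; inj₁; inj₂)
open import Relation.Binary.Definitions using (DecidableEquality)
open import Relation.Binary.PropositionalEquality as P using (_≡_; _≢_)
open import Relation.Nullary using (¬_; Dec; does; yes; no; ¬?)
open import Relation.Nullary.Decidable using (_×-dec_; dec-true; dec-false)
open import Relation.Unary using (Pred; Decidable)

-- Words and deconcatenations

module _ {A : Set} where

  deconcatenations : List A → List (List A × List A)
  deconcatenations []       = ([] , []) ∷ []
  deconcatenations (x ∷ xs) = ([] , x ∷ xs) ∷ map (λ uv → (x ∷ proj₁ uv , proj₂ uv)) (deconcatenations xs)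

  splits≡deconcatenations : (xs : List A) → splits xs ≡ deconcatenations xs
  splits≡deconcatenations xs = P.trans (LP.map-applyUpTo (λ i → i) cut (suc (length xs))) (go xs)
    where
    cut : ℕ → List A × List A
    cut i = take i xs , drop i xs
    go : (xs : List A) → applyUpTo (λ i → take i xs , drop i xs) (suc (length xs)) ≡ deconcatenations xs
    go []       = P.refl
    go (x ∷ xs) = P.cong (([] , x ∷ xs) ∷_) (P.trans
      (P.sym (LP.map-applyUpTo (λ i → take i xs , drop i xs) (λ uv → (x ∷ proj₁ uv , proj₂ uv)) (suc (length xs))))
      (P.cong (map (λ uv → (x ∷ proj₁ uv , proj₂ uv))) (go xs)))

  deconcatenations-++ : (w : List A) → All (λ uv → proj₁ uv ++ proj₂ uv ≡ w) (deconcatenations w)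
  deconcatenations-++ []      = P.refl ∷ []
  deconcatenations-++ (x ∷ w) = P.refl ∷ AllP.map⁺ (All.map (P.cong (x ∷_)) (deconcatenations-++ w))

words-length : ∀ k n → All (λ w → length w ≡ k) (words k n)
words-length zero    n = P.refl ∷ []
words-length (suc k) n = AllP.concat⁺ (AllP.map⁺ {f = λ i → map (i ∷_) (words k n)}
  (AllP.tabulate⁺ {f = λ i → i} λ i → AllP.map⁺ (All.map (P.cong suc) (words-length k n))))

∈-words : ∀ {n} (u : List (Fin n)) → u ∈ words (length u) n
∈-words []      = Any.here P.refl
∈-words {n} (i ∷ u) = MP.∈-concatMap⁺ (λ j → map (j ∷_) (words (length u) n))
  (Any.map (λ { P.refl → MP.∈-map⁺ (i ∷_) (∈-words u) }) (MP.∈-allFin i))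

IsReducedWordOf : ∀ {n} → Permutation′ (suc n) → List (Fin n) → Set
IsReducedWordOf σ w = (∀ x → wordPerm w x ≡ σ ⟨$⟩ʳ x) × length w ≡ inv σ

isReducedWordOf? : ∀ {n} (σ : Permutation′ (suc n)) w → Dec (IsReducedWordOf σ w)
isReducedWordOf? σ w = FP.all? (λ x → wordPerm w x F.≟ σ ⟨$⟩ʳ x) ×-dec (length w ℕ.≟ inv σ)

reducedWords-sound : ∀ {n} (π : Permutation′ (suc n)) → All (IsReducedWordOf π) (reducedWords π)
reducedWords-sound {n} π = All.zipWith (λ { (len , act) → act , len })
  (AllP.filter⁺ _ (words-length (inv π) n) , AllP.all-filter (λ w → FP.all? (λ x → wordPerm w x F.≟ π ⟨$⟩ʳ x)) (words (inv π) n))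

-- Inversions and reduced words

open SemiringSum NP.+-*-semiring
  using (sum; sum-cong-≗; *-distribˡ-sum; sum-permute; sum-replicate-zero) renaming (∑-distrib-+ to sum-distrib-+)

⟦_⟧ : Bool → ℕ
⟦ true ⟧  = 1
⟦ false ⟧ = 0

⟦∧⟧ : ∀ b b′ → ⟦ b ∧ b′ ⟧ ≡ ⟦ b ⟧ ℕ.* ⟦ b′ ⟧
⟦∧⟧ true  b′ = P.sym (NP.+-identityʳ _)
⟦∧⟧ false b′ = P.refl

⟦does⟧-≤-⊎ : ∀ {A B C : Set} (a : Dec A) (b : Dec B) (c : Dec C) → (A → B ⊎ C) →
  ⟦ does a ⟧ ℕ.≤ ⟦ does b ⟧ ℕ.+ ⟦ does c ⟧
⟦does⟧-≤-⊎ (no _)  b       c       f = z≤n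
⟦does⟧-≤-⊎ (yes p) b       c       f with f p
⟦does⟧-≤-⊎ (yes p) (yes _) c       f | inj₁ _  = s≤s z≤n
⟦does⟧-≤-⊎ (yes p) (no ¬b) c       f | inj₁ q  = ⊥-elim (¬b q)
⟦does⟧-≤-⊎ (yes p) b       (yes _) f | inj₂ _  = NP.m≤n+m 1 ⟦ does b ⟧
⟦does⟧-≤-⊎ (yes p) b       (no ¬c) f | inj₂ q  = ⊥-elim (¬c q)

sum-mono : ∀ {m} {f g : Fin m → ℕ} → (∀ x → f x ℕ.≤ g x) → sum f ℕ.≤ sum g
sum-mono {zero}  f≤g = z≤n
sum-mono {suc m} f≤g = NP.+-mono-≤ (f≤g zero) (sum-mono (λ x → f≤g (suc x)))

sum-zero : ∀ {m} (f : Fin m → ℕ) → (∀ x → f x ≡ 0) → sum f ≡ 0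
sum-zero {m} f f≡0 = P.trans (sum-cong-≗ f≡0) (sum-replicate-zero m)

sum-⟦≟⟧ : ∀ {m} (a : Fin m) → sum (λ x → ⟦ does (x F.≟ a) ⟧) ≡ 1
sum-⟦≟⟧ {suc m} zero    = P.cong suc (sum-zero {m} _ (λ _ → P.refl))
sum-⟦≟⟧ {suc m} (suc a) = sum-⟦≟⟧ a

sum-⟦≟∧≟⟧ : ∀ {m} (a b : Fin m) → sum (λ x → sum (λ y → ⟦ does (x F.≟ a) ∧ does (y F.≟ b) ⟧)) ≡ 1
sum-⟦≟∧≟⟧ {m} a b = begin
  sum (λ x → sum (λ y → ⟦ does (x F.≟ a) ∧ does (y F.≟ b) ⟧))
    ≡⟨ sum-cong-≗ {m} (λ x → P.trans (sum-cong-≗ {m} (λ y → ⟦∧⟧ (does (x F.≟ a)) (does (y F.≟ b))))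
                                  (P.sym (*-distribˡ-sum {m} ⟦ does (x F.≟ a) ⟧ _))) ⟩
  sum (λ x → ⟦ does (x F.≟ a) ⟧ ℕ.* sum (λ y → ⟦ does (y F.≟ b) ⟧))
    ≡⟨ sum-cong-≗ {m} (λ x → P.trans (P.cong (⟦ does (x F.≟ a) ⟧ ℕ.*_) (sum-⟦≟⟧ b)) (NP.*-identityʳ _)) ⟩
  sum (λ x → ⟦ does (x F.≟ a) ⟧) ≡⟨ sum-⟦≟⟧ a ⟩
  1 ∎
  where open P.≡-Reasoning

module _ {A : Set} {Q : Pred A 0ℓ} (Q? : Decidable Q) where

  length-filter-∷ : ∀ x xs → length (filter Q? (x ∷ xs)) ≡ ⟦ does (Q? x) ⟧ ℕ.+ length (filter Q? xs)
  length-filter-∷ x xs with does (Q? x)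
  ... | true  = P.refl
  ... | false = P.refl

  length-filter-tabulate : ∀ {m} (h : Fin m → A) → length (filter Q? (tabulate h)) ≡ sum (λ y → ⟦ does (Q? (h y)) ⟧)
  length-filter-tabulate {zero}  h = P.refl
  length-filter-tabulate {suc m} h = P.trans (length-filter-∷ (h zero) (tabulate (λ y → h (suc y))))
    (P.cong (⟦ does (Q? (h zero)) ⟧ ℕ.+_) (length-filter-tabulate (λ y → h (suc y))))

  length-filter-concatMap : ∀ {m} {B : Set} (h : Fin m → B) (g : B → List A) →
    length (filter Q? (concatMap g (tabulate h))) ≡ sum (λ x → length (filter Q? (g (h x))))
  length-filter-concatMap {zero}  h g = P.refl
  length-filter-concatMap {suc m} h g = begin
    length (filter Q? (g (h zero) ++ concatMap g (tabulate (λ x → h (suc x)))))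
      ≡⟨ P.cong length (LP.filter-++ Q? (g (h zero)) _) ⟩
    length (filter Q? (g (h zero)) ++ filter Q? (concatMap g (tabulate (λ x → h (suc x)))))
      ≡⟨ LP.length-++ (filter Q? (g (h zero))) ⟩
    _ ≡⟨ P.cong (length (filter Q? (g (h zero))) ℕ.+_) (length-filter-concatMap (λ x → h (suc x)) g) ⟩
    _ ∎
    where open P.≡-Reasoning

module _ {m : ℕ} where

  inversions : (Fin m → Fin m) → ℕ
  inversions f = sum λ x → sum λ y → ⟦ does (x <? y) ∧ does (f y <? f x) ⟧

  inversions-cong : {f g : Fin m → Fin m} → (∀ x → f x ≡ g x) → inversions f ≡ inversions g
  inversions-cong f≗g = sum-cong-≗ λ x → sum-cong-≗ λ y →
    P.cong₂ (λ p q → ⟦ does (x <? y) ∧ does (p <? q) ⟧) (f≗g y) (f≗g x)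

  inversions-id : inversions (λ x → x) ≡ 0
  inversions-id = sum-zero {m} _ λ x → sum-zero {m} _ λ y → no-two-way (x <? y) (y <? x) NP.<-asym
    where
    no-two-way : ∀ {A B : Set} (a : Dec A) (b : Dec B) → (A → B → ⊥) → ⟦ does a ∧ does b ⟧ ≡ 0
    no-two-way (yes p) (yes q) f = ⊥-elim (f p q)
    no-two-way (yes p) (no _)  f = P.refl
    no-two-way (no _)  b       f = P.refl

inv≡inversions : ∀ {n} (π : Permutation′ (suc n)) → inv π ≡ inversions (π ⟨$⟩ʳ_)
inv≡inversions {n} π = P.trans (length-filter-concatMap IsInversion? (λ i → i) (λ i → map (i ,_) (allFin (suc n))))
  (sum-cong-≗ λ x → P.trans (P.cong (λ z → length (filter IsInversion? z)) (LP.map-tabulate (λ i → i) (x ,_)))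
                            (length-filter-tabulate IsInversion? (x ,_)))
  where
  IsInversion? = λ (ij : Fin (suc n) × Fin (suc n)) →
    (proj₁ ij <? proj₂ ij) ×-dec (π ⟨$⟩ʳ proj₂ ij <? π ⟨$⟩ʳ proj₁ ij)

module _ {m : ℕ} where

  transpose-matchˡ : (a b : Fin m) → PC.transpose a b a ≡ b
  transpose-matchˡ a b with a F.≟ a
  ... | yes _  = P.refl
  ... | no a≢a = ⊥-elim (a≢a P.refl)

  transpose-matchʳ : (a b : Fin m) → PC.transpose a b b ≡ a
  transpose-matchʳ a b with b F.≟ a
  ... | yes b≡a = b≡a
  ... | no _ with b F.≟ b
  ...   | yes _  = P.refl
  ...   | no b≢b = ⊥-elim (b≢b P.refl)

  transpose-mismatch : (a b p : Fin m) → p ≢ a → p ≢ b → PC.transpose a b p ≡ p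
  transpose-mismatch a b p p≢a p≢b with p F.≟ a
  ... | yes p≡a = ⊥-elim (p≢a p≡a)
  ... | no _ with p F.≟ b
  ...   | yes p≡b = ⊥-elim (p≢b p≡b)
  ...   | no _    = P.refl

  data TransposeCase (a b p : Fin m) : Set where
    atˡ   : p ≡ a → PC.transpose a b p ≡ b → TransposeCase a b p
    atʳ   : p ≢ a → p ≡ b → PC.transpose a b p ≡ a → TransposeCase a b p
    fixed : p ≢ a → p ≢ b → PC.transpose a b p ≡ p → TransposeCase a b p

  transpose-case : (a b p : Fin m) → TransposeCase a b p
  transpose-case a b p with p F.≟ a | p F.≟ b
  ... | yes P.refl | _          = atˡ P.refl (transpose-matchˡ p b)
  ... | no p≢a     | yes P.refl = atʳ p≢a P.refl (transpose-matchʳ a p)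
  ... | no p≢a     | no p≢b     = fixed p≢a p≢b (transpose-mismatch a b p p≢a p≢b)

  transpose-involutive : (a b p : Fin m) → PC.transpose a b (PC.transpose a b p) ≡ p
  transpose-involutive a b p with transpose-case a b p
  ... | atˡ p≡a tp    = P.trans (P.cong (PC.transpose a b) tp) (P.trans (transpose-matchʳ a b) (P.sym p≡a))
  ... | atʳ _ p≡b tp  = P.trans (P.cong (PC.transpose a b) tp) (P.trans (transpose-matchˡ a b) (P.sym p≡b))
  ... | fixed _ _ tp  = P.trans (P.cong (PC.transpose a b) tp) tp

module _ {n : ℕ} (i : Fin n) where

  private
    s : Fin (suc n) → Fin (suc n)
    s = PC.transpose (inject₁ i) (suc i)

    i<1+i : inject₁ i F.< suc i
    i<1+i = FP.≤̄⇒inject₁< NP.≤-refl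

  sgen-<-reflects : ∀ p q → s p F.< s q → p F.< q ⊎ (p ≡ suc i × q ≡ inject₁ i)
  sgen-<-reflects p q sp<sq with transpose-case (inject₁ i) (suc i) p | transpose-case (inject₁ i) (suc i) q
  ... | atˡ _ sp | atˡ _ sq = ⊥-elim (FP.<-irrefl P.refl (P.subst₂ F._<_ sp sq sp<sq))
  ... | atˡ _ sp | atʳ _ _ sq = ⊥-elim (NP.<-asym (P.subst₂ F._<_ sp sq sp<sq) i<1+i)
  ... | atˡ P.refl sp | fixed _ _ sq = inj₁ (FP.<-trans i<1+i (P.subst₂ F._<_ sp sq sp<sq))
  ... | atʳ _ p≡ _ | atˡ q≡ _ = inj₂ (p≡ , q≡)
  ... | atʳ _ _ sp | atʳ _ _ sq = ⊥-elim (FP.<-irrefl P.refl (P.subst₂ F._<_ sp sq sp<sq))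
  ... | atʳ _ P.refl sp | fixed _ q≢1+i sq = inj₁ (FP.≤∧≢⇒< 1+i≤q (q≢1+i ∘ P.sym))
    where
    1+i≤q : suc i F.≤ q
    1+i≤q = P.subst (λ k → suc k ℕ.≤ toℕ q) (FP.toℕ-inject₁ i) (P.subst₂ F._<_ sp sq sp<sq)
  ... | fixed p≢i _ sp | atˡ P.refl sq = inj₁ (FP.≤∧≢⇒< p≤i p≢i)
    where
    p≤i : p F.≤ inject₁ i
    p≤i = P.subst (toℕ p ℕ.≤_) (P.sym (FP.toℕ-inject₁ i)) (ℕ.s≤s⁻¹ (P.subst₂ F._<_ sp sq sp<sq))
  ... | fixed _ _ sp | atʳ _ P.refl sq = inj₁ (FP.<-trans (P.subst₂ F._<_ sp sq sp<sq) i<1+i)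
  ... | fixed _ _ sp | fixed _ _ sq = inj₁ (P.subst₂ F._<_ sp sq sp<sq)

module _ {n : ℕ} where

  private
    s : Fin n → Fin (suc n) → Fin (suc n)
    s i x = sgen i ⟨$⟩ʳ x

  sum-∘sgen : (h : Fin (suc n) → ℕ) (i : Fin n) → sum h ≡ sum (λ x → h (s i x))
  sum-∘sgen h i = sum-permute h (sgen i)

  sum-∘wordPerm : (w : List (Fin n)) (h : Fin (suc n) → ℕ) → sum (λ x → h (wordPerm w x)) ≡ sum h
  sum-∘wordPerm []      h = P.refl
  sum-∘wordPerm (i ∷ w) h = P.trans (sum-∘wordPerm w (λ x → h (s i x))) (P.sym (sum-∘sgen h i))

  private
    sum₂ : (Fin (suc n) → Fin (suc n) → ℕ) → ℕ
    sum₂ H = sum λ x → sum λ y → H x y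

    sum₂-+ : (G H : Fin (suc n) → Fin (suc n) → ℕ) → sum₂ (λ x y → G x y ℕ.+ H x y) ≡ sum₂ G ℕ.+ sum₂ H
    sum₂-+ G H = P.trans (sum-cong-≗ (λ x → sum-distrib-+ (G x) (H x))) (sum-distrib-+ (λ x → sum (G x)) (λ x → sum (H x)))

  inversions-∘sgen : (i : Fin n) (f : Fin (suc n) → Fin (suc n)) → inversions (λ x → f (s i x)) ℕ.≤ inversions f ℕ.+ 1
  inversions-∘sgen i f = begin
    inversions (λ x → f (s i x))
      ≡⟨ P.trans (sum-∘sgen (λ x → sum (λ y → ⟦ does (x <? y) ∧ does (f (s i y) <? f (s i x)) ⟧)) i)
                 (sum-cong-≗ (λ x → sum-∘sgen (λ y → ⟦ does (s i x <? y) ∧ does (f (s i y) <? f (s i (s i x))) ⟧) i)) ⟩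
    sum₂ (λ x y → ⟦ does (s i x <? s i y) ∧ does (f (s i (s i y)) <? f (s i (s i x))) ⟧)
      ≡⟨ sum-cong-≗ (λ x → sum-cong-≗ (λ y → P.cong₂ (λ p q → ⟦ does (s i x <? s i y) ∧ does (f p <? f q) ⟧)
           (transpose-involutive (inject₁ i) (suc i) y) (transpose-involutive (inject₁ i) (suc i) x))) ⟩
    sum₂ (λ x y → ⟦ does (s i x <? s i y) ∧ does (f y <? f x) ⟧)
      ≤⟨ sum-mono (λ x → sum-mono (λ y → ⟦does⟧-≤-⊎ ((s i x <? s i y) ×-dec (f y <? f x)) ((x <? y) ×-dec (f y <? f x))
           ((x F.≟ suc i) ×-dec (y F.≟ inject₁ i)) (inversion-or-swapped x y))) ⟩
    sum₂ (λ x y → ⟦ does (x <? y) ∧ does (f y <? f x) ⟧ ℕ.+ ⟦ does (x F.≟ suc i) ∧ does (y F.≟ inject₁ i) ⟧)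
      ≡⟨ sum₂-+ (λ x y → ⟦ does (x <? y) ∧ does (f y <? f x) ⟧) (λ x y → ⟦ does (x F.≟ suc i) ∧ does (y F.≟ inject₁ i) ⟧) ⟩
    inversions f ℕ.+ sum₂ (λ x y → ⟦ does (x F.≟ suc i) ∧ does (y F.≟ inject₁ i) ⟧)
      ≡⟨ P.cong (inversions f ℕ.+_) (sum-⟦≟∧≟⟧ (suc i) (inject₁ i)) ⟩
    inversions f ℕ.+ 1 ∎
    where
    open NP.≤-Reasoning
    inversion-or-swapped : ∀ x y → (s i x F.< s i y) × (f y F.< f x) →
      ((x F.< y) × (f y F.< f x)) ⊎ ((x ≡ suc i) × (y ≡ inject₁ i))
    inversion-or-swapped x y (sx<sy , fy<fx) with sgen-<-reflects i x y sx<sy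
    ... | inj₁ x<y = inj₁ (x<y , fy<fx)
    ... | inj₂ xy  = inj₂ xy

  inversions-sgen∘ : (i : Fin n) (g : Fin (suc n) → Fin (suc n)) → (∀ h → sum (λ x → h (g x)) ≡ sum h) →
    inversions (λ x → s i (g x)) ℕ.≤ inversions g ℕ.+ 1
  inversions-sgen∘ i g g-bij = begin
    inversions (λ x → s i (g x))
      ≤⟨ sum-mono (λ x → sum-mono (λ y → ⟦does⟧-≤-⊎ ((x <? y) ×-dec (s i (g y) <? s i (g x))) ((x <? y) ×-dec (g y <? g x))
           ((g x F.≟ inject₁ i) ×-dec (g y F.≟ suc i)) (inversion-or-swapped x y))) ⟩
    sum₂ (λ x y → ⟦ does (x <? y) ∧ does (g y <? g x) ⟧ ℕ.+ ⟦ does (g x F.≟ inject₁ i) ∧ does (g y F.≟ suc i) ⟧)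
      ≡⟨ sum₂-+ (λ x y → ⟦ does (x <? y) ∧ does (g y <? g x) ⟧) (λ x y → ⟦ does (g x F.≟ inject₁ i) ∧ does (g y F.≟ suc i) ⟧) ⟩
    inversions g ℕ.+ sum₂ (λ x y → ⟦ does (g x F.≟ inject₁ i) ∧ does (g y F.≟ suc i) ⟧)
      ≡⟨ P.cong (inversions g ℕ.+_) (P.trans (g-bij (λ x′ → sum (λ y → ⟦ does (x′ F.≟ inject₁ i) ∧ does (g y F.≟ suc i) ⟧)))
           (P.trans (sum-cong-≗ (λ x → g-bij (λ y′ → ⟦ does (x F.≟ inject₁ i) ∧ does (y′ F.≟ suc i) ⟧)))
                    (sum-⟦≟∧≟⟧ (inject₁ i) (suc i)))) ⟩
    inversions g ℕ.+ 1 ∎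
    where
    open NP.≤-Reasoning
    inversion-or-swapped : ∀ x y → (x F.< y) × (s i (g y) F.< s i (g x)) →
      ((x F.< y) × (g y F.< g x)) ⊎ ((g x ≡ inject₁ i) × (g y ≡ suc i))
    inversion-or-swapped x y (x<y , sgy<sgx) with sgen-<-reflects i (g y) (g x) sgy<sgx
    ... | inj₁ gy<gx          = inj₁ (x<y , gy<gx)
    ... | inj₂ (gy≡ , gx≡)    = inj₂ (gx≡ , gy≡)

  inversions-∘wordPerm : (v : List (Fin n)) (f : Fin (suc n) → Fin (suc n)) →
    inversions (λ x → f (wordPerm v x)) ℕ.≤ inversions f ℕ.+ length v
  inversions-∘wordPerm []      f = NP.m≤m+n (inversions f) 0
  inversions-∘wordPerm (i ∷ v) f = begin
    inversions (λ x → f (s i (wordPerm v x))) ≤⟨ inversions-∘wordPerm v (λ x → f (s i x)) ⟩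
    inversions (λ x → f (s i x)) ℕ.+ length v  ≤⟨ NP.+-monoˡ-≤ (length v) (inversions-∘sgen i f) ⟩
    inversions f ℕ.+ 1 ℕ.+ length v           ≡⟨ NP.+-assoc (inversions f) 1 (length v) ⟩
    inversions f ℕ.+ suc (length v) ∎
    where open NP.≤-Reasoning

  wordPerm-++ : (u v : List (Fin n)) (x : Fin (suc n)) → wordPerm (u ++ v) x ≡ wordPerm u (wordPerm v x)
  wordPerm-++ []      v x = P.refl
  wordPerm-++ (i ∷ u) v x = P.cong (s i) (wordPerm-++ u v x)

  inversions-wordPerm-++ : (u v : List (Fin n)) → inversions (wordPerm (u ++ v)) ℕ.≤ length u ℕ.+ inversions (wordPerm v)
  inversions-wordPerm-++ []      v = NP.≤-refl
  inversions-wordPerm-++ (i ∷ u) v = begin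
    inversions (λ x → s i (wordPerm (u ++ v) x))
      ≤⟨ inversions-sgen∘ i (wordPerm (u ++ v)) (sum-∘wordPerm (u ++ v)) ⟩
    inversions (wordPerm (u ++ v)) ℕ.+ 1         ≤⟨ NP.+-monoˡ-≤ 1 (inversions-wordPerm-++ u v) ⟩
    length u ℕ.+ inversions (wordPerm v) ℕ.+ 1  ≡⟨ NP.+-comm _ 1 ⟩
    suc (length u ℕ.+ inversions (wordPerm v)) ∎
    where open NP.≤-Reasoning

  Reduced : List (Fin n) → Set
  Reduced w = inversions (wordPerm w) ≡ length w

  reduced-++⁻ : (u v : List (Fin n)) → Reduced (u ++ v) → Reduced u × Reduced v
  reduced-++⁻ u v uv-reduced = NP.≤-antisym (word-bound u) u-long , NP.≤-antisym (word-bound v) v-long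
    where
    open NP.≤-Reasoning
    word-bound : ∀ w → inversions (wordPerm w) ℕ.≤ length w
    word-bound w = P.subst (inversions (wordPerm w) ℕ.≤_) (P.cong (ℕ._+ length w) (inversions-id {suc n}))
                     (inversions-∘wordPerm w (λ x → x))
    |u|+|v|≡ : length u ℕ.+ length v ≡ inversions (wordPerm (u ++ v))
    |u|+|v|≡ = P.trans (P.sym (LP.length-++ u)) (P.sym uv-reduced)
    u-long : length u ℕ.≤ inversions (wordPerm u)
    u-long = NP.+-cancelʳ-≤ (length v) (length u) (inversions (wordPerm u)) (begin
      length u ℕ.+ length v                        ≡⟨ |u|+|v|≡ ⟩
      inversions (wordPerm (u ++ v))               ≡⟨ inversions-cong (wordPerm-++ u v) ⟩
      inversions (λ x → wordPerm u (wordPerm v x)) ≤⟨ inversions-∘wordPerm v (wordPerm u) ⟩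
      inversions (wordPerm u) ℕ.+ length v ∎)
    v-long : length v ℕ.≤ inversions (wordPerm v)
    v-long = NP.+-cancelˡ-≤ (length u) (length v) (inversions (wordPerm v)) (begin
      length u ℕ.+ length v          ≡⟨ |u|+|v|≡ ⟩
      inversions (wordPerm (u ++ v)) ≤⟨ inversions-wordPerm-++ u v ⟩
      length u ℕ.+ inversions (wordPerm v) ∎)

reducedWordOf⇒reduced : ∀ {n} (σ : Permutation′ (suc n)) (w : List (Fin n)) → IsReducedWordOf σ w → Reduced w
reducedWordOf⇒reduced σ w (act , len) = P.trans (inversions-cong act) (P.trans (P.sym (inv≡inversions σ)) (P.sym len))

headOr : {A : Set} → A → List A → A
headOr d []      = d
headOr d (x ∷ _) = x

headOr-All : {A : Set} {Q : A → Set} (d : A) (xs : List A) → Q d → All Q xs → Q (headOr d xs)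
headOr-All d []       Qd _          = Qd
headOr-All d (x ∷ xs) Qd (Qx ∷ _)   = Qx

headOr-∈ : {A : Set} (d d′ : A) (xs : List A) {a : A} → a ∈ xs → headOr d xs ≡ headOr d′ xs
headOr-∈ d d′ (x ∷ xs) _ = P.refl

does-⇔ : {A B : Set} (a : Dec A) (b : Dec B) → (A → B) → (B → A) → does a ≡ does b
does-⇔ (yes p) b f g = P.sym (dec-true b (f p))
does-⇔ (no ¬p) b f g = P.sym (dec-false b (¬p ∘ g))

-- Permutation′ cannot be enumerated, so permutations of a given length are indexed by words:
-- canon u is the first word with the length and action of u.
module CanonicalWords (n : ℕ) where

  Word : Set
  Word = List (Fin n)

  permOf : Word → Permutation′ (suc n)
  permOf []      = Perm.id
  permOf (i ∷ u) = permOf u ∘ₚ sgen i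

  permOf-wordPerm : ∀ u x → permOf u ⟨$⟩ʳ x ≡ wordPerm u x
  permOf-wordPerm []      x = P.refl
  permOf-wordPerm (i ∷ u) x = P.cong (sgen i ⟨$⟩ʳ_) (permOf-wordPerm u x)

  inv-permOf : ∀ u → inv (permOf u) ≡ inversions (wordPerm u)
  inv-permOf u = P.trans (inv≡inversions (permOf u)) (inversions-cong (permOf-wordPerm u))

  SameAction : Word → Word → Set
  SameAction w u = ∀ x → wordPerm w x ≡ wordPerm u x

  sameAction? : ∀ w u → Dec (SameAction w u)
  sameAction? w u = FP.all? (λ x → wordPerm w x F.≟ wordPerm u x)

  private
    equivalents : Word → List Word
    equivalents u = filter (λ w → sameAction? w u) (words (length u) n)

    ∈-equivalents : ∀ u → u ∈ equivalents u
    ∈-equivalents u = MP.∈-filter⁺ (λ w → sameAction? w u) (∈-words u) (λ x → P.refl)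

  canon : Word → Word
  canon u = headOr u (equivalents u)

  canon-length : ∀ u → length (canon u) ≡ length u
  canon-length u = headOr-All u (equivalents u) P.refl (AllP.filter⁺ (λ w → sameAction? w u) (words-length (length u) n))

  canon-action : ∀ u → SameAction (canon u) u
  canon-action u = headOr-All u (equivalents u) (λ x → P.refl) (AllP.all-filter (λ w → sameAction? w u) (words (length u) n))

  canon-cong : ∀ u′ u → length u′ ≡ length u → SameAction u′ u → canon u′ ≡ canon u
  canon-cong u′ u |u′|≡|u| u′~u = P.trans (P.cong (headOr u′) same-equivalents) (headOr-∈ u′ u (equivalents u) (∈-equivalents u))
    where
    same-equivalents : equivalents u′ ≡ equivalents u
    same-equivalents = P.trans (P.cong (λ k → filter (λ w → sameAction? w u′) (words k n)) |u′|≡|u|)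
      (LP.filter-≐ (λ w → sameAction? w u′) (λ w → sameAction? w u)
        ((λ w~u′ x → P.trans (w~u′ x) (u′~u x)) , (λ w~u x → P.trans (w~u x) (P.sym (u′~u x))))
        (words (length u) n))

  canon-idem : ∀ u → canon (canon u) ≡ canon u
  canon-idem u = canon-cong (canon u) u (canon-length u) (canon-action u)

-- Quasi-shuffles

antidiagonal : ℕ → List (ℕ × ℕ)
antidiagonal zero    = (0 , 0) ∷ []
antidiagonal (suc t) = (0 , suc t) ∷ map (λ ij → (suc (proj₁ ij) , proj₂ ij)) (antidiagonal t)

-- The pairs (i , j) with i + (j + 1) = c: the parts (i+1) , (j+1) merging into the part c+1.
merges : ℕ → List (ℕ × ℕ)
merges zero    = []
merges (suc c) = (0 , c) ∷ map (λ ij → (suc (proj₁ ij) , proj₂ ij)) (merges c)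

-- The pairs (α , β) with γ ∈ qshuffles α β, with multiplicity: the first part of γ comes
-- from α, from β, or from merging one part of each.
quasiDeshuffles : Comp → List (Comp × Comp)
quasiDeshuffles []      = ([] , []) ∷ []
quasiDeshuffles (c ∷ γ) = concatMap (λ αβ → (c ∷ proj₁ αβ , proj₂ αβ) ∷ (proj₁ αβ , c ∷ proj₂ αβ)
                            ∷ map (λ ij → (proj₁ ij ∷ proj₁ αβ , proj₂ ij ∷ proj₂ αβ)) (merges c)) (quasiDeshuffles γ)

-- Finite sums and linear combinations

module _ {c ℓ} (𝕜 : Field c ℓ) where

  open WithField 𝕜 hiding (zero)
  open import Relation.Binary.Reasoning.Setoid setoid
  open CommSemigroupProps *-commutativeSemigroup using () renaming (interchange to *-interchange; x∙yz≈y∙xz to *-left-comm)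
  open CommSemigroupProps +-commutativeSemigroup using () renaming (interchange to +-interchange; x∙yz≈y∙xz to +-left-comm)
  private module Ring = RingProps ring

  private variable
    a b : Level
    A : Set a
    B : Set b
    C D : Set

  ∑ : List A → (A → K) → K
  ∑ xs f = foldr (λ x r → f x + r) 0# xs

  ∑-cong : (xs : List A) {f g : A → K} → (∀ x → f x ≈ g x) → ∑ xs f ≈ ∑ xs g
  ∑-cong []       f≈g = refl
  ∑-cong (x ∷ xs) f≈g = +-cong (f≈g x) (∑-cong xs f≈g)

  ∑-congᴬ : (xs : List A) {Q : A → Set} → All Q xs → {f g : A → K} → (∀ x → Q x → f x ≈ g x) → ∑ xs f ≈ ∑ xs g
  ∑-congᴬ []       []         f≈g = refl
  ∑-congᴬ (x ∷ xs) (Qx ∷ Qxs) f≈g = +-cong (f≈g x Qx) (∑-congᴬ xs Qxs f≈g)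

  ∑-zero : (xs : List A) {f : A → K} → (∀ x → f x ≈ 0#) → ∑ xs f ≈ 0#
  ∑-zero []       f≈0 = refl
  ∑-zero (x ∷ xs) f≈0 = trans (+-cong (f≈0 x) (∑-zero xs f≈0)) (+-identityˡ 0#)

  ∑-++ : (xs ys : List A) (f : A → K) → ∑ (xs ++ ys) f ≈ ∑ xs f + ∑ ys f
  ∑-++ []       ys f = sym (+-identityˡ _)
  ∑-++ (x ∷ xs) ys f = trans (+-congˡ (∑-++ xs ys f)) (sym (+-assoc _ _ _))

  ∑-map : (g : A → B) (xs : List A) (f : B → K) → ∑ (map g xs) f ≡ ∑ xs (λ x → f (g x))
  ∑-map g []       f = P.refl
  ∑-map g (x ∷ xs) f = P.cong (f (g x) +_) (∑-map g xs f)

  ∑-concatMap : (g : A → List B) (xs : List A) (f : B → K) → ∑ (concatMap g xs) f ≈ ∑ xs (λ x → ∑ (g x) f)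
  ∑-concatMap g []       f = refl
  ∑-concatMap g (x ∷ xs) f = trans (∑-++ (g x) (concatMap g xs) f) (+-congˡ (∑-concatMap g xs f))

  *-distribˡ-∑ : (k : K) (xs : List A) (f : A → K) → k * ∑ xs f ≈ ∑ xs (λ x → k * f x)
  *-distribˡ-∑ k []       f = zeroʳ k
  *-distribˡ-∑ k (x ∷ xs) f = trans (distribˡ k _ _) (+-congˡ (*-distribˡ-∑ k xs f))

  *-distribʳ-∑ : (k : K) (xs : List A) (f : A → K) → ∑ xs f * k ≈ ∑ xs (λ x → f x * k)
  *-distribʳ-∑ k xs f = trans (*-comm _ _) (trans (*-distribˡ-∑ k xs f) (∑-cong xs (λ x → *-comm _ _)))

  ∑-distrib-+ : (xs : List A) (f g : A → K) → ∑ xs (λ x → f x + g x) ≈ ∑ xs f + ∑ xs g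
  ∑-distrib-+ []       f g = sym (+-identityˡ _)
  ∑-distrib-+ (x ∷ xs) f g = trans (+-congˡ (∑-distrib-+ xs f g)) (+-interchange _ _ _ _)

  ∑-comm : (xs : List A) (ys : List B) (f : A → B → K) → ∑ xs (λ x → ∑ ys (f x)) ≈ ∑ ys (λ y → ∑ xs (λ x → f x y))
  ∑-comm []       ys f = sym (∑-zero ys (λ _ → refl))
  ∑-comm (x ∷ xs) ys f = trans (+-congˡ (∑-comm xs ys f)) (sym (∑-distrib-+ ys (f x) _))

  𝟙 : Bool → K
  𝟙 true  = 1#
  𝟙 false = 0#

  𝟙-∧ : ∀ b b′ → 𝟙 (b ∧ b′) ≈ 𝟙 b * 𝟙 b′
  𝟙-∧ true  b′ = sym (*-identityˡ _)
  𝟙-∧ false b′ = sym (zeroˡ _)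

  𝟙-yes : {Q : Set a} (q? : Dec Q) → Q → 𝟙 (does q?) ≈ 1#
  𝟙-yes q? q = reflexive (P.cong 𝟙 (dec-true q? q))

  𝟙-no : {Q : Set a} (q? : Dec Q) → ¬ Q → 𝟙 (does q?) ≈ 0#
  𝟙-no q? ¬q = reflexive (P.cong 𝟙 (dec-false q? ¬q))

  if-then-0 : (b : Bool) (k : K) → (if b then k else 0#) ≈ k * 𝟙 b
  if-then-0 true  k = sym (*-identityʳ k)
  if-then-0 false k = sym (zeroʳ k)

  ∑-filter : {Q : Pred A 0ℓ} (Q? : Decidable Q) (xs : List A) (f : A → K) →
    ∑ (filter Q? xs) f ≈ ∑ xs (λ x → 𝟙 (does (Q? x)) * f x)
  ∑-filter Q? []       f = refl
  ∑-filter Q? (x ∷ xs) f with does (Q? x)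
  ... | true  = +-cong (sym (*-identityˡ _)) (∑-filter Q? xs f)
  ... | false = trans (∑-filter Q? xs f) (sym (trans (+-congʳ (zeroˡ _)) (+-identityˡ _)))

  δ : DecidableEquality A → A → A → K
  δ _≟_ a b = 𝟙 (does (a ≟ b))

  δ-refl : (_≟_ : DecidableEquality A) (a : A) → δ _≟_ a a ≈ 1#
  δ-refl _≟_ a = 𝟙-yes (a ≟ a) P.refl

  δ-≢ : (_≟_ : DecidableEquality A) {a b : A} → a ≢ b → δ _≟_ a b ≈ 0#
  δ-≢ _≟_ {a} {b} a≢b = 𝟙-no (a ≟ b) a≢b

  δ-× : (_≟₁_ : DecidableEquality A) (_≟₂_ : DecidableEquality B) (a a′ : A) (b b′ : B) →
    δ (PP.≡-dec _≟₁_ _≟₂_) (a , b) (a′ , b′) ≈ δ _≟₁_ a a′ * δ _≟₂_ b b′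
  δ-× _≟₁_ _≟₂_ a a′ b b′ with a ≟₁ a′
  ... | yes P.refl = sym (*-identityˡ _)
  ... | no _       = sym (zeroˡ _)

  δ-∷ : (_≟_ : DecidableEquality A) (a a′ : A) (as as′ : List A) →
    δ (LP.≡-dec _≟_) (a ∷ as) (a′ ∷ as′) ≈ δ _≟_ a a′ * δ (LP.≡-dec _≟_) as as′
  δ-∷ _≟_ a a′ as as′ = 𝟙-∧ (does (a ≟ a′)) _

  linK-cong : (x : FV B) {f g : B → K} → (∀ b → f b ≈ g b) → linK f x ≈ linK g x
  linK-cong x f≈g = ∑-cong x (λ kb → *-congˡ (f≈g (proj₂ kb)))

  linK-distrib-+ : (x : FV B) (f g : B → K) → linK (λ b → f b + g b) x ≈ linK f x + linK g x
  linK-distrib-+ x f g = trans (∑-cong x (λ kb → distribˡ _ _ _)) (∑-distrib-+ x _ _)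

  *-distribˡ-linK : (k : K) (x : FV B) (f : B → K) → k * linK f x ≈ linK (λ b → k * f b) x
  *-distribˡ-linK k x f = trans (*-distribˡ-∑ k x _) (∑-cong x (λ kb → *-left-comm k (proj₁ kb) _))

  linK-* : (x : FV B) (y : FV C) (f : B → K) (g : C → K) →
    linK (λ b → linK (λ c → f b * g c) y) x ≈ linK f x * linK g y
  linK-* x y f g = begin
    linK (λ b → linK (λ c → f b * g c) y) x ≈⟨ linK-cong x (λ b → sym (*-distribˡ-linK (f b) y g)) ⟩
    linK (λ b → f b * linK g y) x           ≈⟨ linK-cong x (λ b → *-comm _ _) ⟩
    linK (λ b → linK g y * f b) x           ≈⟨ sym (*-distribˡ-linK _ x f) ⟩
    linK g y * linK f x                     ≈⟨ *-comm _ _ ⟩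
    linK f x * linK g y                     ∎

  linK-comm : (x : FV B) (y : FV C) (F : B → C → K) →
    linK (λ b → linK (F b) y) x ≈ linK (λ c → linK (λ b → F b c) x) y
  linK-comm x y F = begin
    ∑ x (λ kb → proj₁ kb * ∑ y (λ lc → proj₁ lc * F (proj₂ kb) (proj₂ lc)))
      ≈⟨ ∑-cong x (λ kb → *-distribˡ-∑ _ y _) ⟩
    ∑ x (λ kb → ∑ y (λ lc → proj₁ kb * (proj₁ lc * F (proj₂ kb) (proj₂ lc))))
      ≈⟨ ∑-comm x y _ ⟩
    ∑ y (λ lc → ∑ x (λ kb → proj₁ kb * (proj₁ lc * F (proj₂ kb) (proj₂ lc))))
      ≈⟨ ∑-cong y (λ lc → ∑-cong x (λ kb → *-left-comm _ _ _)) ⟩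
    ∑ y (λ lc → ∑ x (λ kb → proj₁ lc * (proj₁ kb * F (proj₂ kb) (proj₂ lc))))
      ≈⟨ ∑-cong y (λ lc → sym (*-distribˡ-∑ _ x _)) ⟩
    ∑ y (λ lc → proj₁ lc * ∑ x (λ kb → proj₁ kb * F (proj₂ kb) (proj₂ lc))) ∎

  linK-∑ : (x : FV B) (xs : List A) (F : B → A → K) → linK (λ b → ∑ xs (F b)) x ≈ ∑ xs (λ a → linK (λ b → F b a) x)
  linK-∑ x xs F = trans (∑-cong x (λ kb → *-distribˡ-∑ _ xs _)) (∑-comm x xs _)

  linK-scale : (k : K) (T : B → C) (z : FV B) (h : C → K) →
    linK h (map (λ lc → (k * proj₁ lc , T (proj₂ lc))) z) ≈ k * linK (λ b → h (T b)) z
  linK-scale k T z h = begin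
    _ ≡⟨ ∑-map _ z _ ⟩
    ∑ z (λ lc → (k * proj₁ lc) * h (T (proj₂ lc))) ≈⟨ ∑-cong z (λ lc → *-assoc _ _ _) ⟩
    ∑ z (λ lc → k * (proj₁ lc * h (T (proj₂ lc)))) ≈⟨ sym (*-distribˡ-∑ k z _) ⟩
    k * linK (λ b → h (T b)) z ∎

  linK-rescaled : (G : K × B → FV C) (T : K × B → C → D) (x : FV B) (h : D → K) →
    linK h (concatMap (λ kb → map (λ lc → (proj₁ kb * proj₁ lc , T kb (proj₂ lc))) (G kb)) x)
      ≈ ∑ x (λ kb → proj₁ kb * linK (λ c → h (T kb c)) (G kb))
  linK-rescaled G T x h = trans (∑-concatMap _ x _) (∑-cong x (λ kb → linK-scale (proj₁ kb) (T kb) (G kb) h))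

  linK-lin : (f : B → FV C) (x : FV B) (h : C → K) → linK h (lin f x) ≈ linK (λ b → linK h (f b)) x
  linK-lin f x h = linK-rescaled (λ kb → f (proj₂ kb)) (λ _ c → c) x h

  linK-tens : (f : A → FV C) (g : B → FV D) (x : FV (A × B)) (h : C × D → K) →
    linK h (tens f g x) ≈ linK (λ ab → linK (λ c → linK (λ d → h (c , d)) (g (proj₂ ab))) (f (proj₁ ab))) x
  linK-tens f g x h = trans (linK-lin _ x h) (linK-cong x (λ ab →
    linK-rescaled (λ _ → g (proj₂ ab)) (λ kc d → (proj₂ kc , d)) (f (proj₁ ab)) h))

  linK-bilin : (f : B → B → FV C) (x y : FV B) (h : C → K) →
    linK h (bilin f x y) ≈ linK (λ b → linK (λ b′ → linK h (f b b′)) y) x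
  linK-bilin f x y h = trans (∑-concatMap _ x _) (∑-cong x λ kb → begin
    _ ≈⟨ ∑-concatMap _ y _ ⟩
    ∑ y (λ lb → linK h (map (λ mc → (proj₁ kb * proj₁ lb * proj₁ mc , proj₂ mc)) (f (proj₂ kb) (proj₂ lb))))
      ≈⟨ ∑-cong y (λ lb → linK-scale (proj₁ kb * proj₁ lb) (λ c → c) (f (proj₂ kb) (proj₂ lb)) h) ⟩
    ∑ y (λ lb → (proj₁ kb * proj₁ lb) * linK h (f (proj₂ kb) (proj₂ lb)))
      ≈⟨ ∑-cong y (λ lb → *-assoc _ _ _) ⟩
    ∑ y (λ lb → proj₁ kb * (proj₁ lb * linK h (f (proj₂ kb) (proj₂ lb))))
      ≈⟨ sym (*-distribˡ-∑ _ y _) ⟩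
    proj₁ kb * linK (λ b′ → linK h (f (proj₂ kb) b′)) y ∎)

  coeff≈linK-δ : (_≟_ : DecidableEquality B) (x : FV B) (b : B) → coeff _≟_ x b ≈ linK (λ b′ → δ _≟_ b′ b) x
  coeff≈linK-δ _≟_ []             b = refl
  coeff≈linK-δ _≟_ ((k , b′) ∷ x) b = +-cong (if-then-0 (does (b′ ≟ b)) k) (coeff≈linK-δ _≟_ x b)

  coeff-lin : (_≟_ : DecidableEquality C) (f : B → FV C) (x : FV B) (c′ : C) →
    coeff _≟_ (lin f x) c′ ≈ linK (λ b → coeff _≟_ (f b) c′) x
  coeff-lin _≟_ f x c′ = begin
    coeff _≟_ (lin f x) c′                          ≈⟨ coeff≈linK-δ _≟_ (lin f x) c′ ⟩
    linK (λ c → δ _≟_ c c′) (lin f x)               ≈⟨ linK-lin f x _ ⟩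
    linK (λ b → linK (λ c → δ _≟_ c c′) (f b)) x    ≈⟨ linK-cong x (λ b → sym (coeff≈linK-δ _≟_ (f b) c′)) ⟩
    linK (λ b → coeff _≟_ (f b) c′) x               ∎

  coeff-tens : (_≟₁_ : DecidableEquality C) (_≟₂_ : DecidableEquality D)
    (f : A → FV C) (g : B → FV D) (x : FV (A × B)) (c′ : C) (d′ : D) →
    coeff (PP.≡-dec _≟₁_ _≟₂_) (tens f g x) (c′ , d′)
      ≈ linK (λ ab → coeff _≟₁_ (f (proj₁ ab)) c′ * coeff _≟₂_ (g (proj₂ ab)) d′) x
  coeff-tens _≟₁_ _≟₂_ f g x c′ d′ = begin
    _ ≈⟨ coeff≈linK-δ _ (tens f g x) (c′ , d′) ⟩
    _ ≈⟨ linK-tens f g x _ ⟩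
    linK (λ ab → linK (λ c → linK (λ d → δ (PP.≡-dec _≟₁_ _≟₂_) (c , d) (c′ , d′)) (g (proj₂ ab))) (f (proj₁ ab))) x
      ≈⟨ linK-cong x (λ ab → linK-cong (f (proj₁ ab)) (λ c → linK-cong (g (proj₂ ab)) (λ d → δ-× _≟₁_ _≟₂_ c c′ d d′))) ⟩
    linK (λ ab → linK (λ c → linK (λ d → δ _≟₁_ c c′ * δ _≟₂_ d d′) (g (proj₂ ab))) (f (proj₁ ab))) x
      ≈⟨ linK-cong x (λ ab → linK-* (f (proj₁ ab)) (g (proj₂ ab)) _ _) ⟩
    linK (λ ab → linK (λ c → δ _≟₁_ c c′) (f (proj₁ ab)) * linK (λ d → δ _≟₂_ d d′) (g (proj₂ ab))) x
      ≈⟨ linK-cong x (λ ab → sym (*-cong (coeff≈linK-δ _≟₁_ (f (proj₁ ab)) c′) (coeff≈linK-δ _≟₂_ (g (proj₂ ab)) d′))) ⟩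
    linK (λ ab → coeff _≟₁_ (f (proj₁ ab)) c′ * coeff _≟₂_ (g (proj₂ ab)) d′) x ∎

  module _ {B : Set} (_≟_ : DecidableEquality B) where

    private
      without : B → FV B → FV B
      without b = filter (λ kb → ¬? (proj₂ kb ≟ b))

      linK-split : (h : B → K) (x : FV B) (b : B) → linK h x ≈ coeff _≟_ x b * h b + linK h (without b x)
      linK-split h []             b = sym (trans (+-identityʳ _) (zeroˡ _))
      linK-split h ((k , b′) ∷ x) b with b′ ≟ b
      ... | yes P.refl = begin
        k * h b′ + linK h x                                          ≈⟨ +-congˡ (linK-split h x b) ⟩
        k * h b′ + (coeff _≟_ x b * h b′ + linK h (without b x))     ≈⟨ sym (+-assoc _ _ _) ⟩
        (k * h b′ + coeff _≟_ x b * h b′) + linK h (without b x)     ≈⟨ +-congʳ (sym (distribʳ _ _ _)) ⟩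
        (k + coeff _≟_ x b) * h b′ + linK h (without b x)            ∎
      ... | no _ = begin
        k * h b′ + linK h x                                          ≈⟨ +-congˡ (linK-split h x b) ⟩
        k * h b′ + (coeff _≟_ x b * h b + linK h (without b x))      ≈⟨ +-left-comm _ _ _ ⟩
        coeff _≟_ x b * h b + (k * h b′ + linK h (without b x))      ≈⟨ +-congʳ (*-congʳ (sym (+-identityˡ _))) ⟩
        (0# + coeff _≟_ x b) * h b + (k * h b′ + linK h (without b x)) ∎

      coeff-without-same : (x : FV B) (b : B) → coeff _≟_ (without b x) b ≈ 0#
      coeff-without-same []             b = refl
      coeff-without-same ((k , b′) ∷ x) b with b′ ≟ b
      ... | yes _  = coeff-without-same x b
      ... | no b′≢b with b′ ≟ b
      ...   | yes b′≡b = ⊥-elim (b′≢b b′≡b)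
      ...   | no _     = trans (+-identityˡ _) (coeff-without-same x b)

      coeff-without-other : (x : FV B) (b b′ : B) → b′ ≢ b → coeff _≟_ (without b x) b′ ≈ coeff _≟_ x b′
      coeff-without-other []              b b′ b′≢b = refl
      coeff-without-other ((k , b″) ∷ x) b b′ b′≢b with b″ ≟ b
      ... | no _ = +-congˡ (coeff-without-other x b b′ b′≢b)
      ... | yes P.refl with b″ ≟ b′
      ...   | yes P.refl = ⊥-elim (b′≢b P.refl)
      ...   | no _       = trans (coeff-without-other x b b′ b′≢b) (sym (+-identityˡ _))

      linK-vanishes-fuel : (h : B → K) (fuel : ℕ) (x : FV B) → length x ℕ.≤ fuel →
        (∀ b → coeff _≟_ x b * h b ≈ 0#) → linK h x ≈ 0#
      linK-vanishes-fuel h fuel       []             _          _     = refl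
      linK-vanishes-fuel h (suc fuel) ((k , b) ∷ x) (s≤s |x|≤) x·h≈0 = begin
        linK h ((k , b) ∷ x)                                          ≈⟨ linK-split h ((k , b) ∷ x) b ⟩
        coeff _≟_ ((k , b) ∷ x) b * h b + linK h (without b ((k , b) ∷ x))
          ≈⟨ +-cong (x·h≈0 b) (linK-vanishes-fuel h fuel (without b ((k , b) ∷ x)) shorter rest≈0) ⟩
        0# + 0#                                                       ≈⟨ +-identityˡ _ ⟩
        0#                                                            ∎
        where
        shorter : length (without b ((k , b) ∷ x)) ℕ.≤ fuel
        shorter with b ≟ b
        ... | yes _  = NP.≤-trans (LP.length-filter _ x) |x|≤
        ... | no b≢b = ⊥-elim (b≢b P.refl)
        rest≈0 : ∀ b′ → coeff _≟_ (without b ((k , b) ∷ x)) b′ * h b′ ≈ 0#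
        rest≈0 b′ with b′ ≟ b
        ... | yes P.refl = trans (*-congʳ (coeff-without-same ((k , b) ∷ x) b)) (zeroˡ _)
        ... | no b′≢b    = trans (*-congʳ (coeff-without-other ((k , b) ∷ x) b b′ b′≢b)) (x·h≈0 b′)

    linK-vanishes : (h : B → K) (x : FV B) → (∀ b → coeff _≟_ x b * h b ≈ 0#) → linK h x ≈ 0#
    linK-vanishes h x = linK-vanishes-fuel h (length x) x NP.≤-refl

    linK-supported : (x : FV B) {Q : B → Set} (Q? : ∀ b → Dec (Q b)) {f g : B → K} →
      (∀ b → ¬ Q b → coeff _≟_ x b ≈ 0#) → (∀ b → Q b → f b ≈ g b) → linK f x ≈ linK g x
    linK-supported x Q? {f} {g} off-Q≈0 f≈g = begin
      linK f x                               ≈⟨ linK-cong x (λ b → sym (g+[f-g]≈f b)) ⟩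
      linK (λ b → g b + (f b - g b)) x       ≈⟨ linK-distrib-+ x _ _ ⟩
      linK g x + linK (λ b → f b - g b) x    ≈⟨ +-congˡ (linK-vanishes _ x difference≈0) ⟩
      linK g x + 0#                          ≈⟨ +-identityʳ _ ⟩
      linK g x                               ∎
      where
      g+[f-g]≈f : ∀ b → g b + (f b - g b) ≈ f b
      g+[f-g]≈f b = trans (+-congˡ (+-comm _ _)) (trans (sym (+-assoc _ _ _))
                      (trans (+-congʳ (-‿inverseʳ _)) (+-identityˡ _)))
      difference≈0 : ∀ b → coeff _≟_ x b * (f b - g b) ≈ 0#
      difference≈0 b with Q? b
      ... | yes q = trans (*-congˡ (trans (+-congʳ (f≈g b q)) (-‿inverseʳ _))) (zeroʳ _)
      ... | no ¬q = trans (*-congʳ (off-Q≈0 b ¬q)) (zeroˡ _)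

    linK-resp : (h : B → K) (x y : FV B) → EqV _≟_ x y → linK h x ≈ linK h y
    linK-resp h x y x≈y = begin
      linK h x                                  ≈⟨ sym (+-identityʳ _) ⟩
      linK h x + 0#                             ≈⟨ +-congˡ (sym (-‿inverseˡ _)) ⟩
      linK h x + (- linK h y + linK h y)        ≈⟨ sym (+-assoc _ _ _) ⟩
      (linK h x - linK h y) + linK h y          ≈⟨ +-congʳ (+-congˡ (sym (linK-neg y))) ⟩
      (linK h x + linK h (neg y)) + linK h y    ≈⟨ +-congʳ (sym (∑-++ x (neg y) _)) ⟩
      linK h (x ++ neg y) + linK h y            ≈⟨ +-congʳ (linK-vanishes h (x ++ neg y) difference≈0) ⟩
      0# + linK h y                             ≈⟨ +-identityˡ _ ⟩
      linK h y                                  ∎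
      where
      neg : FV B → FV B
      neg = map (λ kb → (- proj₁ kb , proj₂ kb))
      linK-neg : ∀ z → linK h (neg z) ≈ - linK h z
      linK-neg []             = sym Ring.-0#≈0#
      linK-neg ((k , b) ∷ z) = trans (+-cong (sym (Ring.-‿distribˡ-* _ _)) (linK-neg z)) (Ring.-‿+-comm _ _)
      coeff-++ : ∀ z z′ b → coeff _≟_ (z ++ z′) b ≈ coeff _≟_ z b + coeff _≟_ z′ b
      coeff-++ []             z′ b = sym (+-identityˡ _)
      coeff-++ ((k , b′) ∷ z) z′ b = trans (+-congˡ (coeff-++ z z′ b)) (sym (+-assoc _ _ _))
      coeff-neg : ∀ z b → coeff _≟_ (neg z) b ≈ - coeff _≟_ z b
      coeff-neg []             b = sym Ring.-0#≈0#
      coeff-neg ((k , b′) ∷ z) b with does (b′ ≟ b)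
      ... | true  = trans (+-congˡ (coeff-neg z b)) (Ring.-‿+-comm _ _)
      ... | false = trans (+-congˡ (coeff-neg z b)) (trans (+-congʳ (sym Ring.-0#≈0#)) (Ring.-‿+-comm _ _))
      difference≈0 : ∀ b → coeff _≟_ (x ++ neg y) b * h b ≈ 0#
      difference≈0 b = trans (*-congʳ (trans (coeff-++ x (neg y) b) (trans (+-congˡ (coeff-neg y b))
                         (trans (+-congʳ (x≈y b)) (-‿inverseʳ _))))) (zeroˡ _)


  -- Compositions and the coalgebra QSym

  δC : Comp → Comp → K
  δC = δ _≟C_

  𝟙≡ : ℕ → ℕ → K
  𝟙≡ m n = 𝟙 (does (m ℕ.≟ n))

  ∑-deconcatenations-δ : (_≟_ : DecidableEquality A) (w u v : List A) →
    ∑ (deconcatenations w) (λ st → δ (LP.≡-dec _≟_) (proj₁ st) u * δ (LP.≡-dec _≟_) (proj₂ st) v) ≈ δ (LP.≡-dec _≟_) w (u ++ v)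
  ∑-deconcatenations-δ _≟_ []      []      v = trans (+-identityʳ _) (*-identityˡ _)
  ∑-deconcatenations-δ _≟_ []      (y ∷ u) v = trans (+-identityʳ _) (zeroˡ _)
  ∑-deconcatenations-δ _≟_ (x ∷ w) []      v =
    trans (+-cong (*-identityˡ _) (trans (reflexive (∑-map _ (deconcatenations w) _)) (∑-zero (deconcatenations w) (λ _ → zeroˡ _))))
          (+-identityʳ _)
  ∑-deconcatenations-δ _≟_ (x ∷ w) (y ∷ u) v = begin
    0# * _ + ∑ (map _ (deconcatenations w)) _
      ≈⟨ +-cong (zeroˡ _) (reflexive (∑-map _ (deconcatenations w) _)) ⟩
    0# + ∑ (deconcatenations w) (λ st → δL (x ∷ proj₁ st) (y ∷ u) * δL (proj₂ st) v)
      ≈⟨ +-identityˡ _ ⟩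
    ∑ (deconcatenations w) (λ st → δL (x ∷ proj₁ st) (y ∷ u) * δL (proj₂ st) v)
      ≈⟨ ∑-cong (deconcatenations w) (λ st → trans (*-congʳ (δ-∷ _≟_ x y (proj₁ st) u)) (*-assoc _ _ _)) ⟩
    ∑ (deconcatenations w) (λ st → δ _≟_ x y * (δL (proj₁ st) u * δL (proj₂ st) v))
      ≈⟨ sym (*-distribˡ-∑ _ (deconcatenations w) _) ⟩
    δ _≟_ x y * ∑ (deconcatenations w) (λ st → δL (proj₁ st) u * δL (proj₂ st) v)
      ≈⟨ *-congˡ (∑-deconcatenations-δ _≟_ w u v) ⟩
    δ _≟_ x y * δL w (u ++ v)
      ≈⟨ sym (δ-∷ _≟_ x y w (u ++ v)) ⟩
    δL (x ∷ w) (y ∷ u ++ v) ∎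
    where
    δL = δ (LP.≡-dec _≟_)

  coeff-lin-ΔQ : (X : FV Comp) (β γ : Comp) → coeff (PP.≡-dec _≟C_ _≟C_) (lin ΔQ X) (β , γ) ≈ coeff _≟C_ X (β ++ γ)
  coeff-lin-ΔQ X β γ = begin
    coeff (PP.≡-dec _≟C_ _≟C_) (lin ΔQ X) (β , γ)                ≈⟨ coeff-lin _ ΔQ X (β , γ) ⟩
    linK (λ α → coeff (PP.≡-dec _≟C_ _≟C_) (ΔQ α) (β , γ)) X     ≈⟨ linK-cong X ΔQ-coeff ⟩
    linK (λ α → δC α (β ++ γ)) X                                 ≈⟨ sym (coeff≈linK-δ _≟C_ X (β ++ γ)) ⟩
    coeff _≟C_ X (β ++ γ)                                        ∎
    where
    ΔQ-coeff : ∀ α → coeff (PP.≡-dec _≟C_ _≟C_) (ΔQ α) (β , γ) ≈ δC α (β ++ γ)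
    ΔQ-coeff α = begin
      coeff (PP.≡-dec _≟C_ _≟C_) (ΔQ α) (β , γ)
        ≈⟨ coeff≈linK-δ _ (ΔQ α) (β , γ) ⟩
      ∑ (map _ (splits α)) _
        ≡⟨ P.trans (∑-map _ (splits α) _) (P.cong (λ s → ∑ s _) (splits≡deconcatenations α)) ⟩
      ∑ (deconcatenations α) (λ st → 1# * δ (PP.≡-dec _≟C_ _≟C_) st (β , γ))
        ≈⟨ ∑-cong (deconcatenations α) (λ st → trans (*-identityˡ _) (δ-× _≟C_ _≟C_ (proj₁ st) β (proj₂ st) γ)) ⟩
      ∑ (deconcatenations α) (λ st → δC (proj₁ st) β * δC (proj₂ st) γ)
        ≈⟨ ∑-deconcatenations-δ ℕ._≟_ α β γ ⟩
      δC α (β ++ γ) ∎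

  ∑-compsSuc-δ : (m : ℕ) (F : Comp → K) (γ : Comp) →
    ∑ (compsSuc m) (λ α → F α * δC α γ) ≈ 𝟙≡ ∣ γ ∣c (suc m) * F γ
  ∑-compsSuc-δ zero    F []               = trans (+-identityʳ _) (trans (zeroʳ _) (sym (zeroˡ _)))
  ∑-compsSuc-δ zero    F (zero ∷ [])      = trans (+-identityʳ _) (trans (*-identityʳ _) (sym (*-identityˡ _)))
  ∑-compsSuc-δ zero    F (zero ∷ _ ∷ _)   = trans (+-identityʳ _) (trans (zeroʳ _) (sym (zeroˡ _)))
  ∑-compsSuc-δ zero    F (suc _ ∷ _)      = trans (+-identityʳ _) (trans (zeroʳ _) (sym (zeroˡ _)))
  -- compsSuc (m+1) lists, for each α in compsSuc m, first 1α and then α with its first part enlarged.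
  ∑-compsSuc-δ (suc m) F [] = trans (∑-concatMap _ (compsSuc m) _) (trans (∑-zero (compsSuc m) λ
    { [] → trans (+-identityʳ _) (zeroʳ _) ; (_ ∷ _) → trans (+-cong (zeroʳ _) (trans (+-identityʳ _) (zeroʳ _))) (+-identityʳ _) })
    (sym (zeroˡ _)))
  ∑-compsSuc-δ (suc m) F (zero ∷ γ) = trans (∑-concatMap _ (compsSuc m) _) (trans (∑-cong (compsSuc m) λ
    { [] → +-identityʳ _ ; (_ ∷ _) → trans (+-congˡ (trans (+-identityʳ _) (zeroʳ _))) (+-identityʳ _) })
    (∑-compsSuc-δ m (λ α → F (0 ∷ α)) γ))
  ∑-compsSuc-δ (suc m) F (suc h ∷ γ) = trans (∑-concatMap _ (compsSuc m) _) (trans (∑-cong (compsSuc m) λ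
    { [] → trans (+-identityʳ _) (trans (zeroʳ _) (sym (zeroʳ _)))
    ; (_ ∷ _) → trans (+-cong (zeroʳ _) (+-identityʳ _)) (+-identityˡ _) })
    (∑-compsSuc-δ m enlarged (h ∷ γ)))
    where
    enlarged : Comp → K
    enlarged []      = 0#
    enlarged (h ∷ t) = F (suc h ∷ t)

  ∑-comps-δ : (m : ℕ) (F : Comp → K) (γ : Comp) → ∑ (comps m) (λ α → F α * δC α γ) ≈ 𝟙≡ ∣ γ ∣c m * F γ
  ∑-comps-δ zero    F []      = trans (+-identityʳ _) (trans (*-identityʳ _) (sym (*-identityˡ _)))
  ∑-comps-δ zero    F (_ ∷ _) = trans (+-identityʳ _) (trans (zeroʳ _) (sym (zeroˡ _)))
  ∑-comps-δ (suc m) F γ       = ∑-compsSuc-δ m F γ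

  singlePart : ℕ → Comp
  singlePart zero    = []
  singlePart (suc d) = d ∷ []

  singlePart-∣∣ : ∀ a d → ∣ a ∷ [] ∣c ≡ d → singlePart d ≡ a ∷ []
  singlePart-∣∣ a d |a|≡d = P.subst (λ z → singlePart z ≡ a ∷ []) (P.trans (P.cong suc (P.sym (NP.+-identityʳ a))) |a|≡d) P.refl

  ζQ≈δ-singlePart : ∀ d α → ∣ α ∣c ≡ d → ζQ α ≈ δC α (singlePart d)
  ζQ≈δ-singlePart _ []            P.refl = refl
  ζQ≈δ-singlePart d (a ∷ [])      |a|≡d  = trans (sym (δ-refl _≟C_ (a ∷ []))) (reflexive (P.cong (δC (a ∷ [])) (P.sym (singlePart-∣∣ a d |a|≡d))))
  ζQ≈δ-singlePart d (a ∷ b ∷ α)   _      = sym (δ-≢ _≟C_ (not-single d))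
    where
    not-single : ∀ d → a ∷ b ∷ α ≢ singlePart d
    not-single zero    ()
    not-single (suc d) ()

  Homogeneous : ℕ → FV Comp → Set ℓ
  Homogeneous d X = ∀ α → ¬ ∣ α ∣c ≡ d → coeff _≟C_ X α ≈ 0#

  linK-ζQ-homogeneous : (d : ℕ) (X : FV Comp) → Homogeneous d X → linK ζQ X ≈ coeff _≟C_ X (singlePart d)
  linK-ζQ-homogeneous d X X-homogeneous = begin
    linK ζQ X                           ≈⟨ linK-supported _≟C_ X (λ α → ∣ α ∣c ℕ.≟ d) X-homogeneous (ζQ≈δ-singlePart d) ⟩
    linK (λ α → δC α (singlePart d)) X  ≈⟨ sym (coeff≈linK-δ _≟C_ X (singlePart d)) ⟩
    coeff _≟C_ X (singlePart d)         ∎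

  linK-εQ : (X : FV Comp) → linK εQ X ≈ coeff _≟C_ X []
  linK-εQ X = trans (linK-cong X εQ≈δ) (sym (coeff≈linK-δ _≟C_ X []))
    where
    εQ≈δ : ∀ α → εQ α ≈ δC α []
    εQ≈δ []      = refl
    εQ≈δ (_ ∷ _) = refl

  module _ {B : Set} (deg : B → ℕ) (Δ : B → FV (B × B)) (ε′ ζ′ : B → K) (Z : Comp → B → K)
           (Z-graded : ∀ α b → ¬ ∣ α ∣c ≡ deg b → Z α b ≈ 0#)
           (Z-[] : ∀ b → Z [] b ≈ ε′ b)
           (Z-singlePart : ∀ b → Z (singlePart (deg b)) b ≈ ζ′ b)
           (Z-∷ : ∀ a β b → linK (λ bb → Z (a ∷ []) (proj₁ bb) * Z β (proj₂ bb)) (Δ b) ≈ Z (a ∷ β) b) where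

    coalgebraMap-unique : (Φ : B → FV Comp) →
      (∀ b → Homogeneous (deg b) (Φ b)) →
      (∀ b → tens Φ Φ (Δ b) ≈QQ lin ΔQ (Φ b)) →
      (∀ b → linK εQ (Φ b) ≈ ε′ b) →
      (∀ b → linK ζQ (Φ b) ≈ ζ′ b) →
      ∀ α b → coeff _≟C_ (Φ b) α ≈ Z α b
    coalgebraMap-unique Φ homogeneous comult counit compatible = coeff-Φ
      where
      coeff-Φ-single : ∀ b a → coeff _≟C_ (Φ b) (a ∷ []) ≈ Z (a ∷ []) b
      coeff-Φ-single b a with ∣ a ∷ [] ∣c ℕ.≟ deg b
      ... | yes |a|≡d = P.subst (λ α → coeff _≟C_ (Φ b) α ≈ Z α b) (singlePart-∣∣ a (deg b) |a|≡d) (begin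
        coeff _≟C_ (Φ b) (singlePart (deg b)) ≈⟨ sym (linK-ζQ-homogeneous (deg b) (Φ b) (homogeneous b)) ⟩
        linK ζQ (Φ b)                         ≈⟨ compatible b ⟩
        ζ′ b                                  ≈⟨ sym (Z-singlePart b) ⟩
        Z (singlePart (deg b)) b              ∎)
      ... | no |a|≢d = trans (homogeneous b (a ∷ []) |a|≢d) (sym (Z-graded (a ∷ []) b |a|≢d))

      coeff-Φ : ∀ α b → coeff _≟C_ (Φ b) α ≈ Z α b
      coeff-Φ []      b = trans (sym (linK-εQ (Φ b))) (trans (counit b) (sym (Z-[] b)))
      coeff-Φ (a ∷ β) b = begin
        coeff _≟C_ (Φ b) ((a ∷ []) ++ β)                               ≈⟨ sym (coeff-lin-ΔQ (Φ b) (a ∷ []) β) ⟩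
        coeff (PP.≡-dec _≟C_ _≟C_) (lin ΔQ (Φ b)) (a ∷ [] , β)          ≈⟨ sym (comult b (a ∷ [] , β)) ⟩
        coeff (PP.≡-dec _≟C_ _≟C_) (tens Φ Φ (Δ b)) (a ∷ [] , β)        ≈⟨ coeff-tens _≟C_ _≟C_ Φ Φ (Δ b) (a ∷ []) β ⟩
        linK (λ bb → coeff _≟C_ (Φ (proj₁ bb)) (a ∷ []) * coeff _≟C_ (Φ (proj₂ bb)) β) (Δ b)
          ≈⟨ linK-cong (Δ b) (λ bb → *-cong (coeff-Φ-single (proj₁ bb) a) (coeff-Φ β (proj₂ bb))) ⟩
        linK (λ bb → Z (a ∷ []) (proj₁ bb) * Z β (proj₂ bb)) (Δ b)     ≈⟨ Z-∷ a β b ⟩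
        Z (a ∷ β) b                                                    ∎

  if-*ʳ : (b : Bool) (x y : K) → (if b then x else 0#) * y ≈ (if b then x * y else 0#)
  if-*ʳ true  x y = refl
  if-*ʳ false x y = zeroˡ y

  if-*ˡ : (b : Bool) (x y : K) → y * (if b then x else 0#) ≈ (if b then y * x else 0#)
  if-*ˡ true  x y = refl
  if-*ˡ false x y = zeroʳ y

  if-cong : (b : Bool) {x y : K} → x ≈ y → (if b then x else 0#) ≈ (if b then y else 0#)
  if-cong true  x≈y = x≈y
  if-cong false x≈y = refl

  if-0# : (b : Bool) → (if b then 0# else 0#) ≈ 0#
  if-0# true  = refl
  if-0# false = refl

  ∑-if : (b : Bool) (xs : List A) (f : A → K) → ∑ xs (λ x → if b then f x else 0#) ≈ (if b then ∑ xs f else 0#)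
  ∑-if true  xs f = refl
  ∑-if false xs f = ∑-zero xs (λ _ → refl)

  if-*-if : (b₁ b₂ : Bool) (x y : K) → (if b₁ then x else 0#) * (if b₂ then y else 0#) ≈ (if b₁ then (if b₂ then x * y else 0#) else 0#)
  if-*-if true  true  x y = refl
  if-*-if true  false x y = zeroʳ _
  if-*-if false b₂    x y = zeroˡ _

  if-if-cong : {b₁ b₁′ b₂ b₂′ : Bool} → b₁ ≡ b₁′ → b₂ ≡ b₂′ → {x y : K} → x ≈ y →
    (if b₁ then (if b₂ then x else 0#) else 0#) ≈ (if b₁′ then (if b₂′ then y else 0#) else 0#)
  if-if-cong {true}  {b₂ = true}  P.refl P.refl x≈y = x≈y
  if-if-cong {true}  {b₂ = false} P.refl P.refl x≈y = refl
  if-if-cong {false}              P.refl P.refl x≈y = refl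

  suc-≤ᵇ-suc : ∀ t n → (suc t ≤ᵇ suc n) ≡ (t ≤ᵇ n)
  suc-≤ᵇ-suc zero    n = P.refl
  suc-≤ᵇ-suc (suc t) n = P.refl

  -- A deconcatenation (u , v) of w with ∣u∣ ≥ t is (take t w ++ u′ , v) for a deconcatenation (u′ , v) of drop t w.
  ∑-deconcatenations-drop : (t : ℕ) (w : List A) (G : List A → List A → List A → K) →
    ∑ (deconcatenations w) (λ st → if t ≤ᵇ length (proj₁ st) then G (take t (proj₁ st)) (drop t (proj₁ st)) (proj₂ st) else 0#)
      ≈ (if t ≤ᵇ length w then ∑ (deconcatenations (drop t w)) (λ st → G (take t w) (proj₁ st) (proj₂ st)) else 0#)
  ∑-deconcatenations-drop zero    w       G = refl
  ∑-deconcatenations-drop (suc t) []      G = +-identityʳ _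
  ∑-deconcatenations-drop (suc t) (x ∷ w) G = begin
    0# + ∑ (map _ (deconcatenations w)) _
      ≈⟨ +-identityˡ _ ⟩
    ∑ (map _ (deconcatenations w)) _
      ≡⟨ ∑-map _ (deconcatenations w) _ ⟩
    ∑ (deconcatenations w) (λ st → if suc t ≤ᵇ suc (length (proj₁ st)) then G (x ∷ take t (proj₁ st)) (drop t (proj₁ st)) (proj₂ st) else 0#)
      ≈⟨ ∑-cong (deconcatenations w) (λ st → reflexive (P.cong (λ b → if b then G (x ∷ take t (proj₁ st)) (drop t (proj₁ st)) (proj₂ st) else 0#)
           (suc-≤ᵇ-suc t (length (proj₁ st))))) ⟩
    ∑ (deconcatenations w) (λ st → if t ≤ᵇ length (proj₁ st) then G (x ∷ take t (proj₁ st)) (drop t (proj₁ st)) (proj₂ st) else 0#)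
      ≈⟨ ∑-deconcatenations-drop t w (λ u → G (x ∷ u)) ⟩
    (if t ≤ᵇ length w then ∑ (deconcatenations (drop t w)) (λ st → G (x ∷ take t w) (proj₁ st) (proj₂ st)) else 0#)
      ≡⟨ P.cong (λ b → if b then ∑ (deconcatenations (drop t w)) (λ st → G (x ∷ take t w) (proj₁ st) (proj₂ st)) else 0#)
           (P.sym (suc-≤ᵇ-suc t (length w))) ⟩
    _ ∎

  ∑-merges-𝟙≡ : ∀ c a b → ∑ (merges c) (λ ij → 𝟙≡ a (proj₁ ij) * 𝟙≡ b (proj₂ ij)) ≈ 𝟙≡ (a ℕ.+ suc b) c
  ∑-merges-𝟙≡ zero    a       b = sym (𝟙-no (a ℕ.+ suc b ℕ.≟ 0) (λ eq → NP.1+n≢0 (P.trans (P.sym (NP.+-suc a b)) eq)))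
  ∑-merges-𝟙≡ (suc c) zero    b = begin
    1# * 𝟙≡ b c + ∑ (map _ (merges c)) _       ≈⟨ +-cong (*-identityˡ _) (reflexive (∑-map _ (merges c) _)) ⟩
    𝟙≡ b c + ∑ (merges c) (λ ij → 0# * _)      ≈⟨ +-congˡ (∑-zero (merges c) (λ ij → zeroˡ _)) ⟩
    𝟙≡ b c + 0#                                ≈⟨ +-identityʳ _ ⟩
    𝟙≡ b c                                     ∎
  ∑-merges-𝟙≡ (suc c) (suc a) b = begin
    0# * _ + ∑ (map _ (merges c)) _            ≈⟨ +-cong (zeroˡ _) (reflexive (∑-map _ (merges c) _)) ⟩
    0# + _                                     ≈⟨ +-identityˡ _ ⟩
    _                                          ≈⟨ ∑-merges-𝟙≡ c a b ⟩
    𝟙≡ (a ℕ.+ suc b) c                         ∎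

  private
    ∑-map-∷-δ : ∀ (a : ℕ) (γs : List Comp) (c : ℕ) (γ : Comp) →
      ∑ (map (a ∷_) γs) (λ γ′ → δC γ′ (c ∷ γ)) ≈ 𝟙≡ a c * ∑ γs (λ γ′ → δC γ′ γ)
    ∑-map-∷-δ a γs c γ = trans (reflexive (∑-map _ γs _))
      (trans (∑-cong γs (λ γ′ → δ-∷ ℕ._≟_ a c γ′ γ)) (sym (*-distribˡ-∑ _ γs _)))

    qshuffles-[] : ∀ α → qshuffles α [] ≡ α ∷ []
    qshuffles-[] []      = P.refl
    qshuffles-[] (_ ∷ _) = P.refl

  ∑-qshuffles-δ : ∀ γ α β → ∑ (qshuffles α β) (λ γ′ → δC γ′ γ)
    ≈ ∑ (quasiDeshuffles γ) (λ αβ → δC α (proj₁ αβ) * δC β (proj₂ αβ))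
  ∑-qshuffles-δ [] []      []      = +-congʳ (sym (*-identityʳ _))
  ∑-qshuffles-δ [] []      (_ ∷ _) = +-congʳ (sym (zeroʳ _))
  ∑-qshuffles-δ [] (_ ∷ _) []      = +-congʳ (sym (zeroˡ _))
  ∑-qshuffles-δ [] (a ∷ α) (b ∷ β) = begin
    ∑ (qshuffles (a ∷ α) (b ∷ β)) (λ γ′ → δC γ′ [])
      ≈⟨ ∑-++ (map (a ∷_) (qshuffles α (b ∷ β))) _ _ ⟩
    _ ≈⟨ +-cong (reflexive (∑-map _ (qshuffles α (b ∷ β)) _)) (∑-++ (map (b ∷_) (qshuffles (a ∷ α) β)) _ _) ⟩
    _ ≈⟨ +-cong (∑-zero (qshuffles α (b ∷ β)) (λ _ → refl))
          (+-cong (trans (reflexive (∑-map _ (qshuffles (a ∷ α) β) _)) (∑-zero (qshuffles (a ∷ α) β) (λ _ → refl)))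
                  (trans (reflexive (∑-map _ (qshuffles α β) _)) (∑-zero (qshuffles α β) (λ _ → refl)))) ⟩
    0# + (0# + 0#)  ≈⟨ trans (+-identityˡ _) (+-identityˡ _) ⟩
    0#              ≈⟨ sym (trans (+-congʳ (zeroˡ _)) (+-identityˡ _)) ⟩
    ∑ (quasiDeshuffles []) (λ αβ → δC (a ∷ α) (proj₁ αβ) * δC (b ∷ β) (proj₂ αβ)) ∎
  ∑-qshuffles-δ (c ∷ γ) [] [] = trans (+-identityˡ _) (sym (trans (∑-concatMap _ (quasiDeshuffles γ) _)
    (∑-zero (quasiDeshuffles γ) λ αβ → trans (+-cong (zeroˡ _) (+-cong (zeroʳ _)
      (trans (reflexive (∑-map _ (merges c) _)) (∑-zero (merges c) (λ _ → zeroˡ _))))) (trans (+-identityˡ _) (+-identityˡ _)))))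
  ∑-qshuffles-δ (c ∷ γ) [] (b ∷ β) = begin
    δC (b ∷ β) (c ∷ γ) + 0#                    ≈⟨ +-identityʳ _ ⟩
    δC (b ∷ β) (c ∷ γ)                         ≈⟨ δ-∷ ℕ._≟_ b c β γ ⟩
    𝟙≡ b c * δC β γ                            ≈⟨ *-congˡ (sym (+-identityʳ _)) ⟩
    𝟙≡ b c * ∑ (qshuffles [] β) (λ γ′ → δC γ′ γ) ≈⟨ *-congˡ (∑-qshuffles-δ γ [] β) ⟩
    𝟙≡ b c * ∑ (quasiDeshuffles γ) (λ αβ → δC [] (proj₁ αβ) * δC β (proj₂ αβ)) ≈⟨ *-distribˡ-∑ _ (quasiDeshuffles γ) _ ⟩
    _ ≈⟨ sym (trans (∑-concatMap _ (quasiDeshuffles γ) _) (∑-cong (quasiDeshuffles γ) λ αβ →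
          trans (+-cong (zeroˡ _) (+-cong (*-congˡ (δ-∷ ℕ._≟_ b c β (proj₂ αβ)))
            (trans (reflexive (∑-map _ (merges c) _)) (∑-zero (merges c) (λ _ → zeroˡ _)))))
          (trans (+-identityˡ _) (trans (+-identityʳ _) (*-left-comm _ _ _))))) ⟩
    ∑ (quasiDeshuffles (c ∷ γ)) (λ αβ → δC [] (proj₁ αβ) * δC (b ∷ β) (proj₂ αβ)) ∎
  ∑-qshuffles-δ (c ∷ γ) (a ∷ α) [] = begin
    δC (a ∷ α) (c ∷ γ) + 0#                    ≈⟨ +-identityʳ _ ⟩
    δC (a ∷ α) (c ∷ γ)                         ≈⟨ δ-∷ ℕ._≟_ a c α γ ⟩
    𝟙≡ a c * δC α γ                            ≈⟨ *-congˡ (sym (trans (reflexive (P.cong (λ γs → ∑ γs (λ γ′ → δC γ′ γ)) (qshuffles-[] α))) (+-identityʳ _))) ⟩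
    𝟙≡ a c * ∑ (qshuffles α []) (λ γ′ → δC γ′ γ) ≈⟨ *-congˡ (∑-qshuffles-δ γ α []) ⟩
    𝟙≡ a c * ∑ (quasiDeshuffles γ) (λ αβ → δC α (proj₁ αβ) * δC [] (proj₂ αβ)) ≈⟨ *-distribˡ-∑ _ (quasiDeshuffles γ) _ ⟩
    _ ≈⟨ sym (trans (∑-concatMap _ (quasiDeshuffles γ) _) (∑-cong (quasiDeshuffles γ) λ αβ →
          trans (+-cong (*-congʳ (δ-∷ ℕ._≟_ a c α (proj₁ αβ))) (+-cong (zeroʳ _)
            (trans (reflexive (∑-map _ (merges c) _)) (∑-zero (merges c) (λ _ → zeroʳ _)))))
          (trans (+-congˡ (+-identityˡ _)) (trans (+-identityʳ _) (*-assoc _ _ _))))) ⟩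
    ∑ (quasiDeshuffles (c ∷ γ)) (λ αβ → δC (a ∷ α) (proj₁ αβ) * δC [] (proj₂ αβ)) ∎
  ∑-qshuffles-δ (c ∷ γ) (a ∷ α) (b ∷ β) = begin
    ∑ (qshuffles (a ∷ α) (b ∷ β)) (λ γ′ → δC γ′ (c ∷ γ))
      ≈⟨ ∑-++ (map (a ∷_) (qshuffles α (b ∷ β))) _ _ ⟩
    _ ≈⟨ +-cong (∑-map-∷-δ a (qshuffles α (b ∷ β)) c γ) (∑-++ (map (b ∷_) (qshuffles (a ∷ α) β)) _ _) ⟩
    _ ≈⟨ +-cong (*-congˡ (∑-qshuffles-δ γ α (b ∷ β)))
                (+-cong (trans (∑-map-∷-δ b (qshuffles (a ∷ α) β) c γ) (*-congˡ (∑-qshuffles-δ γ (a ∷ α) β)))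
                        (trans (∑-map-∷-δ (a ℕ.+ suc b) (qshuffles α β) c γ) (*-congˡ (∑-qshuffles-δ γ α β)))) ⟩
    𝟙≡ a c * ∑ 𝒟 T₁ + (𝟙≡ b c * ∑ 𝒟 T₂ + 𝟙≡ (a ℕ.+ suc b) c * ∑ 𝒟 T₃)
      ≈⟨ +-cong (*-distribˡ-∑ _ 𝒟 _) (+-cong (*-distribˡ-∑ _ 𝒟 _) (trans (*-congʳ (sym (∑-merges-𝟙≡ c a b))) (*-distribˡ-∑ _ 𝒟 _))) ⟩
    ∑ 𝒟 (λ αβ → 𝟙≡ a c * T₁ αβ) + (∑ 𝒟 (λ αβ → 𝟙≡ b c * T₂ αβ) + ∑ 𝒟 (λ αβ → M * T₃ αβ))
      ≈⟨ +-congˡ (sym (∑-distrib-+ 𝒟 _ _)) ⟩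
    _ ≈⟨ sym (∑-distrib-+ 𝒟 _ _) ⟩
    ∑ 𝒟 (λ αβ → 𝟙≡ a c * T₁ αβ + (𝟙≡ b c * T₂ αβ + M * T₃ αβ)) ≈⟨ ∑-cong 𝒟 by-first-part ⟩
    _ ≈⟨ sym (∑-concatMap _ 𝒟 _) ⟩
    ∑ (quasiDeshuffles (c ∷ γ)) (λ αβ → δC (a ∷ α) (proj₁ αβ) * δC (b ∷ β) (proj₂ αβ)) ∎
    where
    𝒟 = quasiDeshuffles γ
    T₁ T₂ T₃ : Comp × Comp → K
    T₁ αβ = δC α (proj₁ αβ) * δC (b ∷ β) (proj₂ αβ)
    T₂ αβ = δC (a ∷ α) (proj₁ αβ) * δC β (proj₂ αβ)
    T₃ αβ = δC α (proj₁ αβ) * δC β (proj₂ αβ)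
    M = ∑ (merges c) (λ ij → 𝟙≡ a (proj₁ ij) * 𝟙≡ b (proj₂ ij))
    by-first-part : ∀ αβ → 𝟙≡ a c * T₁ αβ + (𝟙≡ b c * T₂ αβ + M * T₃ αβ) ≈
      ∑ ((c ∷ proj₁ αβ , proj₂ αβ) ∷ (proj₁ αβ , c ∷ proj₂ αβ) ∷ map (λ ij → (proj₁ ij ∷ proj₁ αβ , proj₂ ij ∷ proj₂ αβ)) (merges c))
        (λ αβ → δC (a ∷ α) (proj₁ αβ) * δC (b ∷ β) (proj₂ αβ))
    by-first-part (α′ , β′) = +-cong
      (trans (sym (*-assoc _ _ _)) (*-congʳ (sym (δ-∷ ℕ._≟_ a c α α′))))
      (+-cong (trans (*-left-comm _ _ _) (*-congˡ (sym (δ-∷ ℕ._≟_ b c β β′))))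
        (sym (begin
          ∑ (map (λ ij → (proj₁ ij ∷ α′ , proj₂ ij ∷ β′)) (merges c)) (λ αβ → δC (a ∷ α) (proj₁ αβ) * δC (b ∷ β) (proj₂ αβ))
            ≡⟨ ∑-map _ (merges c) _ ⟩
          _ ≈⟨ ∑-cong (merges c) (λ ij → trans (*-cong (δ-∷ ℕ._≟_ a (proj₁ ij) α α′) (δ-∷ ℕ._≟_ b (proj₂ ij) β β′)) (*-interchange _ _ _ _)) ⟩
          _ ≈⟨ sym (*-distribʳ-∑ _ (merges c) _) ⟩
          M * T₃ (α′ , β′) ∎)))

  coeff-bilin-prodQ : (X Y : FV Comp) (γ : Comp) →
    coeff _≟C_ (bilin prodQ X Y) γ ≈ ∑ (quasiDeshuffles γ) (λ αβ → coeff _≟C_ X (proj₁ αβ) * coeff _≟C_ Y (proj₂ αβ))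
  coeff-bilin-prodQ X Y γ = begin
    coeff _≟C_ (bilin prodQ X Y) γ
      ≈⟨ coeff≈linK-δ _≟C_ (bilin prodQ X Y) γ ⟩
    _ ≈⟨ linK-bilin prodQ X Y _ ⟩
    linK (λ α → linK (λ β → linK (λ γ′ → δC γ′ γ) (prodQ α β)) Y) X
      ≈⟨ linK-cong X (λ α → linK-cong Y (λ β → trans (reflexive (∑-map _ (qshuffles α β) _))
           (trans (∑-cong (qshuffles α β) (λ γ′ → *-identityˡ _)) (∑-qshuffles-δ γ α β)))) ⟩
    linK (λ α → linK (λ β → ∑ 𝒟 (λ αβ → δC α (proj₁ αβ) * δC β (proj₂ αβ))) Y) X
      ≈⟨ linK-cong X (λ α → trans (linK-∑ Y 𝒟 _) (∑-cong 𝒟 (λ αβ →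
           trans (sym (*-distribˡ-linK _ Y _)) (*-congˡ (sym (coeff≈linK-δ _≟C_ Y (proj₂ αβ))))))) ⟩
    linK (λ α → ∑ 𝒟 (λ αβ → δC α (proj₁ αβ) * coeff _≟C_ Y (proj₂ αβ))) X
      ≈⟨ linK-∑ X 𝒟 _ ⟩
    ∑ 𝒟 (λ αβ → linK (λ α → δC α (proj₁ αβ) * coeff _≟C_ Y (proj₂ αβ)) X)
      ≈⟨ ∑-cong 𝒟 (λ αβ → trans (linK-cong X (λ α → *-comm _ _)) (trans (sym (*-distribˡ-linK _ X _))
           (trans (*-comm _ _) (*-congʳ (sym (coeff≈linK-δ _≟C_ X (proj₁ αβ))))))) ⟩
    ∑ 𝒟 (λ αβ → coeff _≟C_ X (proj₁ αβ) * coeff _≟C_ Y (proj₂ αβ)) ∎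
    where
    𝒟 = quasiDeshuffles γ

  ∑-antidiagonal-sucʳ : ∀ t (H : ℕ → ℕ → K) → ∑ (antidiagonal (suc t)) (λ ij → H (proj₁ ij) (proj₂ ij))
    ≈ ∑ (antidiagonal t) (λ ij → H (proj₁ ij) (suc (proj₂ ij))) + H (suc t) 0
  ∑-antidiagonal-sucʳ zero    H = trans (+-congˡ (+-identityʳ _)) (sym (+-congʳ (+-identityʳ _)))
  ∑-antidiagonal-sucʳ (suc t) H = begin
    H 0 (suc (suc t)) + ∑ (map _ (antidiagonal (suc t))) _
      ≡⟨ P.cong (H 0 (suc (suc t)) +_) (∑-map _ (antidiagonal (suc t)) _) ⟩
    H 0 (suc (suc t)) + ∑ (antidiagonal (suc t)) (λ ij → H (suc (proj₁ ij)) (proj₂ ij))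
      ≈⟨ +-congˡ (∑-antidiagonal-sucʳ t (λ i j → H (suc i) j)) ⟩
    H 0 (suc (suc t)) + (∑ (antidiagonal t) (λ ij → H (suc (proj₁ ij)) (suc (proj₂ ij))) + H (suc (suc t)) 0)
      ≈⟨ sym (+-assoc _ _ _) ⟩
    _ ≈⟨ +-congʳ (+-congˡ (reflexive (P.sym (∑-map _ (antidiagonal t) _)))) ⟩
    _ ∎

  ∑-antidiagonal-merges : ∀ c (H : ℕ → ℕ → K) → ∑ (antidiagonal c) (λ ij → H (proj₁ ij) (proj₂ ij))
    ≈ ∑ (merges c) (λ ij → H (proj₁ ij) (suc (proj₂ ij))) + H c 0
  ∑-antidiagonal-merges zero    H = trans (+-identityʳ _) (sym (+-identityˡ _))
  ∑-antidiagonal-merges (suc c) H = begin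
    H 0 (suc c) + ∑ (map _ (antidiagonal c)) _
      ≡⟨ P.cong (H 0 (suc c) +_) (∑-map _ (antidiagonal c) _) ⟩
    H 0 (suc c) + ∑ (antidiagonal c) (λ ij → H (suc (proj₁ ij)) (proj₂ ij))
      ≈⟨ +-congˡ (∑-antidiagonal-merges c (λ i j → H (suc i) j)) ⟩
    H 0 (suc c) + (∑ (merges c) (λ ij → H (suc (proj₁ ij)) (suc (proj₂ ij))) + H (suc c) 0)
      ≈⟨ sym (+-assoc _ _ _) ⟩
    _ ≈⟨ +-congʳ (+-congˡ (reflexive (P.sym (∑-map _ (merges c) _)))) ⟩
    _ ∎

  ∑-antidiagonal-axis : ∀ t (H : ℕ → ℕ → K) → (∀ i j → H i (suc j) ≈ 0#) →
    ∑ (antidiagonal t) (λ ij → H (proj₁ ij) (proj₂ ij)) ≈ H t 0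
  ∑-antidiagonal-axis zero    H H≈0 = +-identityʳ _
  ∑-antidiagonal-axis (suc t) H H≈0 = trans (+-cong (H≈0 0 t) (reflexive (∑-map _ (antidiagonal t) _)))
    (trans (+-identityˡ _) (∑-antidiagonal-axis t (λ i j → H (suc i) j) (λ i j → H≈0 (suc i) j)))

  ∑-antidiagonal-pascal : ∀ t (G G₁ G₂ : ℕ → ℕ → K) →
    (∀ t → G 0 (suc t) ≈ G₂ 0 t) → (∀ i → G (suc i) 0 ≈ G₁ i 0) →
    (∀ i j → G (suc i) (suc j) ≈ G₁ i (suc j) + G₂ (suc i) j) →
    ∑ (antidiagonal t) (λ ij → G₁ (proj₁ ij) (proj₂ ij)) + ∑ (antidiagonal t) (λ ij → G₂ (proj₁ ij) (proj₂ ij))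
      ≈ G 0 (suc t) + ∑ (antidiagonal t) (λ ij → G (suc (proj₁ ij)) (proj₂ ij))
  ∑-antidiagonal-pascal zero G G₁ G₂ G-0ʳ G-0ˡ G-suc = begin
    (G₁ 0 0 + 0#) + (G₂ 0 0 + 0#) ≈⟨ +-cong (+-identityʳ _) (+-identityʳ _) ⟩
    G₁ 0 0 + G₂ 0 0               ≈⟨ +-comm _ _ ⟩
    G₂ 0 0 + G₁ 0 0               ≈⟨ +-cong (sym (G-0ʳ 0)) (trans (sym (G-0ˡ 0)) (sym (+-identityʳ _))) ⟩
    G 0 1 + (G 1 0 + 0#)          ∎
  ∑-antidiagonal-pascal (suc t) G G₁ G₂ G-0ʳ G-0ˡ G-suc = begin
    ∑ (antidiagonal (suc t)) (λ ij → G₁ (proj₁ ij) (proj₂ ij)) + ∑ (antidiagonal (suc t)) (λ ij → G₂ (proj₁ ij) (proj₂ ij))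
      ≈⟨ +-cong (∑-antidiagonal-sucʳ t G₁) (+-congˡ (reflexive (∑-map _ (antidiagonal t) _))) ⟩
    (S₁ + G₁ (suc t) 0) + (G₂ 0 (suc t) + S₂)
      ≈⟨ shuffle-terms _ _ _ _ ⟩
    G₂ 0 (suc t) + ((S₁ + S₂) + G₁ (suc t) 0)
      ≈⟨ +-cong (sym (G-0ʳ (suc t))) (+-cong (sym (∑-distrib-+ (antidiagonal t) _ _)) (sym (G-0ˡ (suc t)))) ⟩
    G 0 (suc (suc t)) + (∑ (antidiagonal t) (λ ij → G₁ (proj₁ ij) (suc (proj₂ ij)) + G₂ (suc (proj₁ ij)) (proj₂ ij)) + G (suc (suc t)) 0)
      ≈⟨ +-congˡ (+-congʳ (∑-cong (antidiagonal t) (λ ij → sym (G-suc (proj₁ ij) (proj₂ ij))))) ⟩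
    G 0 (suc (suc t)) + (∑ (antidiagonal t) (λ ij → G (suc (proj₁ ij)) (suc (proj₂ ij))) + G (suc (suc t)) 0)
      ≈⟨ +-congˡ (sym (∑-antidiagonal-sucʳ t (λ i j → G (suc i) j))) ⟩
    G 0 (suc (suc t)) + ∑ (antidiagonal (suc t)) (λ ij → G (suc (proj₁ ij)) (proj₂ ij)) ∎
    where
    S₁ = ∑ (antidiagonal t) (λ ij → G₁ (proj₁ ij) (suc (proj₂ ij)))
    S₂ = ∑ (antidiagonal t) (λ ij → G₂ (suc (proj₁ ij)) (proj₂ ij))
    shuffle-terms : ∀ a b c d → (a + b) + (c + d) ≈ c + ((a + d) + b)
    shuffle-terms a b c d = begin
      (a + b) + (c + d) ≈⟨ +-comm _ _ ⟩
      (c + d) + (a + b) ≈⟨ +-assoc _ _ _ ⟩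
      c + (d + (a + b)) ≈⟨ +-congˡ (sym (+-assoc _ _ _)) ⟩
      c + ((d + a) + b) ≈⟨ +-congˡ (+-congʳ (+-comm _ _)) ⟩
      c + ((a + d) + b) ∎

  module _ {X : Set} where

    shuffles-[]ʳ : (v : List X) → shuffles v [] ≡ v ∷ []
    shuffles-[]ʳ []      = P.refl
    shuffles-[]ʳ (_ ∷ _) = P.refl

    shuffleCut : (F : List X → List X → K) (v w : List X) (i j : ℕ) → K
    shuffleCut F v w i j = if i ≤ᵇ length v then (if j ≤ᵇ length w then
      ∑ (shuffles (take i v) (take j w)) (λ p → ∑ (shuffles (drop i v) (drop j w)) (λ s → F p s)) else 0#) else 0#

    -- The prefix of length t of a shuffle of v and w is a shuffle of prefixes of v and w of lengths i + j = t.
    ∑-shuffles-cut : ∀ t (v w : List X) (F : List X → List X → K) →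
      ∑ (shuffles v w) (λ u → if t ≤ᵇ length u then F (take t u) (drop t u) else 0#)
        ≈ ∑ (antidiagonal t) (λ ij → shuffleCut F v w (proj₁ ij) (proj₂ ij))
    ∑-shuffles-cut zero    v       w       F = sym (trans (+-identityʳ _) (+-identityʳ _))
    ∑-shuffles-cut (suc t) []      w       F = trans (+-identityʳ _) (sym (trans
      (+-congˡ (trans (reflexive (∑-map _ (antidiagonal t) _)) (∑-zero (antidiagonal t) (λ _ → refl))))
      (trans (+-identityʳ _) (if-cong (suc t ≤ᵇ length w) (trans (+-identityʳ _) (+-identityʳ _))))))
    ∑-shuffles-cut (suc t) (x ∷ v) []      F = trans (+-identityʳ _) (sym (begin
      0# + ∑ (map _ (antidiagonal t)) _
        ≈⟨ trans (+-identityˡ _) (reflexive (∑-map _ (antidiagonal t) _)) ⟩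
      ∑ (antidiagonal t) (λ ij → shuffleCut F (x ∷ v) [] (suc (proj₁ ij)) (proj₂ ij))
        ≈⟨ ∑-antidiagonal-axis t (λ i j → shuffleCut F (x ∷ v) [] (suc i) j) (λ i j → if-0# (suc i ≤ᵇ suc (length v))) ⟩
      shuffleCut F (x ∷ v) [] (suc t) 0
        ≈⟨ if-cong (suc t ≤ᵇ suc (length v)) (trans (+-identityʳ _)
             (trans (reflexive (P.cong (λ z → ∑ z (F (x ∷ take t v))) (shuffles-[]ʳ (drop t v)))) (+-identityʳ _))) ⟩
      _ ∎))
    ∑-shuffles-cut (suc t) (x ∷ v) (y ∷ w) F = begin
      ∑ (map (x ∷_) (shuffles v (y ∷ w)) ++ map (y ∷_) (shuffles (x ∷ v) w)) cut
        ≈⟨ ∑-++ (map (x ∷_) (shuffles v (y ∷ w))) _ _ ⟩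
      _ ≈⟨ +-cong (reflexive (∑-map _ (shuffles v (y ∷ w)) _)) (reflexive (∑-map _ (shuffles (x ∷ v) w) _)) ⟩
      _ ≈⟨ +-cong (∑-cong (shuffles v (y ∷ w)) (λ u → reflexive (P.cong (λ b → if b then F (x ∷ take t u) (drop t u) else 0#) (suc-≤ᵇ-suc t (length u)))))
                  (∑-cong (shuffles (x ∷ v) w) (λ u → reflexive (P.cong (λ b → if b then F (y ∷ take t u) (drop t u) else 0#) (suc-≤ᵇ-suc t (length u))))) ⟩
      _ ≈⟨ +-cong (∑-shuffles-cut t v (y ∷ w) (λ p → F (x ∷ p))) (∑-shuffles-cut t (x ∷ v) w (λ p → F (y ∷ p))) ⟩
      _ ≈⟨ ∑-antidiagonal-pascal t (shuffleCut F (x ∷ v) (y ∷ w)) (shuffleCut (λ p → F (x ∷ p)) v (y ∷ w))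
             (shuffleCut (λ p → F (y ∷ p)) (x ∷ v) w) first-from-w first-from-v both ⟩
      _ ≈⟨ +-congˡ (reflexive (P.sym (∑-map _ (antidiagonal t) _))) ⟩
      _ ∎
      where
      cut : List X → K
      cut u = if suc t ≤ᵇ length u then F (take (suc t) u) (drop (suc t) u) else 0#
      first-from-w : ∀ t → shuffleCut F (x ∷ v) (y ∷ w) 0 (suc t) ≈ shuffleCut (λ p → F (y ∷ p)) (x ∷ v) w 0 t
      first-from-w t = reflexive (P.cong (λ b → if b then ∑ (shuffles (x ∷ v) (drop t w)) (F (y ∷ take t w)) + 0# else 0#)
                                          (suc-≤ᵇ-suc t (length w)))
      first-from-v : ∀ i → shuffleCut F (x ∷ v) (y ∷ w) (suc i) 0 ≈ shuffleCut (λ p → F (x ∷ p)) v (y ∷ w) i 0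
      first-from-v i = trans
        (reflexive (P.cong (λ b → if b then ∑ (shuffles (drop i v) (y ∷ w)) (F (x ∷ take i v)) + 0# else 0#) (suc-≤ᵇ-suc i (length v))))
        (if-cong (i ≤ᵇ length v) (reflexive (P.cong (λ z → ∑ z (λ p → ∑ (shuffles (drop i v) (y ∷ w)) (λ s → F (x ∷ p) s)))
                                                     (P.sym (shuffles-[]ʳ (take i v))))))
      both : ∀ i j → shuffleCut F (x ∷ v) (y ∷ w) (suc i) (suc j)
        ≈ shuffleCut (λ p → F (x ∷ p)) v (y ∷ w) i (suc j) + shuffleCut (λ p → F (y ∷ p)) (x ∷ v) w (suc i) j
      both i j = begin
        _ ≈⟨ if-cong (suc i ≤ᵇ suc (length v)) (if-cong (suc j ≤ᵇ suc (length w))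
               (trans (∑-++ (map (x ∷_) (shuffles (take i v) (y ∷ take j w))) _ _)
                      (+-cong (reflexive (∑-map _ (shuffles (take i v) (y ∷ take j w)) _))
                              (reflexive (∑-map _ (shuffles (x ∷ take i v) (take j w)) _))))) ⟩
        _ ≈⟨ if-if-+ (i ≤ᵇ length v) (j ≤ᵇ length w) (suc i ≤ᵇ suc (length v)) (suc j ≤ᵇ suc (length w))
               (suc-≤ᵇ-suc i _) (suc-≤ᵇ-suc j _) _ _ ⟩
        _ ∎
        where
        if-if-+ : (b₁ b₂ b₁′ b₂′ : Bool) → b₁′ ≡ b₁ → b₂′ ≡ b₂ → (k₁ k₂ : K) →
          (if b₁′ then (if b₂′ then k₁ + k₂ else 0#) else 0#) ≈
          (if b₁ then (if b₂′ then k₁ else 0#) else 0#) + (if b₁′ then (if b₂ then k₂ else 0#) else 0#)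
        if-if-+ true  true  .true  .true  P.refl P.refl k₁ k₂ = refl
        if-if-+ true  false .true  .false P.refl P.refl k₁ k₂ = sym (+-identityʳ _)
        if-if-+ false b₂    .false .b₂    P.refl P.refl k₁ k₂ = sym (+-identityʳ _)

  -- The coproduct of Π lies in Π ⊗ Π

  linK-ΔW : (F : BW × BW → K) (n : ℕ) (w : List (Fin n)) →
    linK F (ΔW (n , w)) ≈ ∑ (deconcatenations w) (λ st → F ((n , proj₁ st) , (n , proj₂ st)))
  linK-ΔW F n w = begin
    linK F (ΔW (n , w))                                                    ≡⟨ ∑-map _ (splits w) _ ⟩
    ∑ (splits w) (λ st → 1# * F ((n , proj₁ st) , (n , proj₂ st)))        ≡⟨ P.cong (λ s → ∑ s _) (splits≡deconcatenations w) ⟩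
    ∑ (deconcatenations w) (λ st → 1# * F ((n , proj₁ st) , (n , proj₂ st))) ≈⟨ ∑-cong (deconcatenations w) (λ st → *-identityˡ _) ⟩
    ∑ (deconcatenations w) (λ st → F ((n , proj₁ st) , (n , proj₂ st)))   ∎

  ∑-allFin-δ : ∀ {m} (j : Fin m) → ∑ (allFin m) (λ i → δ F._≟_ i j) ≈ 1#
  ∑-allFin-δ {suc m} j = trans (+-congˡ (reflexive (P.trans
      (P.cong (λ is → ∑ is (λ i → δ F._≟_ i j)) (P.sym (LP.map-tabulate (λ i → i) suc)))
      (∑-map suc (allFin m) (λ i → δ F._≟_ i j))))) (split j)
    where
    split : (j : Fin (suc m)) → δ F._≟_ zero j + ∑ (allFin m) (λ i → δ F._≟_ (suc i) j) ≈ 1#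
    split zero    = trans (+-congˡ (∑-zero (allFin m) (λ _ → refl))) (+-identityʳ _)
    split (suc j) = trans (+-identityˡ _) (∑-allFin-δ j)

  module _ {n : ℕ} where

    private
      Word = List (Fin n)
      _≟L_ : DecidableEquality Word
      _≟L_ = LP.≡-dec F._≟_
      δL : Word → Word → K
      δL = δ _≟L_

    ∑-words-δ : ∀ k (u : Word) → ∑ (words k n) (λ w → δL w u) ≈ 𝟙≡ (length u) k
    ∑-words-δ zero    []      = +-identityʳ _
    ∑-words-δ zero    (_ ∷ _) = +-identityʳ _
    ∑-words-δ (suc k) u = trans (∑-concatMap _ (allFin n) _)
      (trans (∑-cong (allFin n) (λ i → reflexive (∑-map (i ∷_) (words k n) _))) (by-first-letter u))
      where
      by-first-letter : (u : Word) → ∑ (allFin n) (λ i → ∑ (words k n) (λ w → δL (i ∷ w) u)) ≈ 𝟙≡ (length u) (suc k)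
      by-first-letter []      = ∑-zero (allFin n) (λ i → ∑-zero (words k n) (λ w → refl))
      by-first-letter (j ∷ u) = begin
        ∑ (allFin n) (λ i → ∑ (words k n) (λ w → δL (i ∷ w) (j ∷ u)))
          ≈⟨ ∑-cong (allFin n) (λ i → trans (∑-cong (words k n) (λ w → δ-∷ F._≟_ i j w u)) (sym (*-distribˡ-∑ _ (words k n) _))) ⟩
        ∑ (allFin n) (λ i → δ F._≟_ i j * ∑ (words k n) (λ w → δL w u))
          ≈⟨ ∑-cong (allFin n) (λ i → *-congˡ (∑-words-δ k u)) ⟩
        ∑ (allFin n) (λ i → δ F._≟_ i j * 𝟙≡ (length u) k)
          ≈⟨ sym (*-distribʳ-∑ _ (allFin n) _) ⟩
        ∑ (allFin n) (λ i → δ F._≟_ i j) * 𝟙≡ (length u) k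
          ≈⟨ trans (*-congʳ (∑-allFin-δ j)) (*-identityˡ _) ⟩
        𝟙≡ (length u) k ∎

    δW-same : (w u : Word) → δ _≟W_ (n , w) (n , u) ≈ δL w u
    δW-same w u with n ℕ.≟ n
    ... | yes P.refl = refl
    ... | no n≢n     = ⊥-elim (n≢n P.refl)

    δW-≢ : (m : ℕ) (w : Word) (u : List (Fin m)) → n ≢ m → δ _≟W_ (n , w) (m , u) ≈ 0#
    δW-≢ m w u n≢m with n ℕ.≟ m
    ... | yes n≡m = ⊥-elim (n≢m n≡m)
    ... | no _    = refl

    𝟙-R : Permutation′ (suc n) → Word → K
    𝟙-R σ w = 𝟙 (does (isReducedWordOf? σ w))

    𝟙-R-resp : ∀ σ {w w′} → length w ≡ length w′ → (∀ x → wordPerm w x ≡ wordPerm w′ x) → 𝟙-R σ w ≈ 𝟙-R σ w′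
    𝟙-R-resp σ {w} {w′} |w|≡ w~w′ = reflexive (P.cong 𝟙 (does-⇔ (isReducedWordOf? σ w) (isReducedWordOf? σ w′)
      (λ { (act , len) → (λ x → P.trans (P.sym (w~w′ x)) (act x)) , P.trans (P.sym |w|≡) len })
      (λ { (act , len) → (λ x → P.trans (w~w′ x) (act x)) , P.trans |w|≡ len })))

    ∑-reducedWords-δ : (σ : Permutation′ (suc n)) (u : Word) → ∑ (reducedWords σ) (λ w → δL w u) ≈ 𝟙-R σ u
    ∑-reducedWords-δ σ u = begin
      ∑ (reducedWords σ) (λ w → δL w u)
        ≈⟨ ∑-filter _ (words (inv σ) n) _ ⟩
      ∑ (words (inv σ) n) (λ w → 𝟙 (acts-as-σ w) * δL w u)
        ≈⟨ ∑-cong (words (inv σ) n) move-indicator ⟩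
      ∑ (words (inv σ) n) (λ w → 𝟙 (acts-as-σ u) * δL w u)
        ≈⟨ sym (*-distribˡ-∑ _ (words (inv σ) n) _) ⟩
      𝟙 (acts-as-σ u) * ∑ (words (inv σ) n) (λ w → δL w u)
        ≈⟨ *-congˡ (∑-words-δ (inv σ) u) ⟩
      𝟙 (acts-as-σ u) * 𝟙≡ (length u) (inv σ)
        ≈⟨ sym (𝟙-∧ (acts-as-σ u) _) ⟩
      𝟙-R σ u ∎
      where
      acts-as-σ : Word → Bool
      acts-as-σ w = does (FP.all? (λ x → wordPerm w x F.≟ σ ⟨$⟩ʳ x))
      move-indicator : ∀ w → 𝟙 (acts-as-σ w) * δL w u ≈ 𝟙 (acts-as-σ u) * δL w u
      move-indicator w with w ≟L u
      ... | yes P.refl = refl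
      ... | no _       = trans (zeroʳ _) (sym (zeroʳ _))

    coeff-ι : (σ : Permutation′ (suc n)) (u : Word) → coeff _≟W_ (ι (n , σ)) (n , u) ≈ 𝟙-R σ u
    coeff-ι σ u = begin
      coeff _≟W_ (ι (n , σ)) (n , u)           ≈⟨ coeff≈linK-δ _≟W_ (ι (n , σ)) (n , u) ⟩
      _                                        ≡⟨ ∑-map _ (reducedWords σ) _ ⟩
      _                                        ≈⟨ ∑-cong (reducedWords σ) (λ w → trans (*-identityˡ _) (δW-same w u)) ⟩
      ∑ (reducedWords σ) (λ w → δL w u)        ≈⟨ ∑-reducedWords-δ σ u ⟩
      𝟙-R σ u                                  ∎

    coeff-ι-≢ : (σ : Permutation′ (suc n)) (m : ℕ) (u : List (Fin m)) → n ≢ m → coeff _≟W_ (ι (n , σ)) (m , u) ≈ 0#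
    coeff-ι-≢ σ m u n≢m = begin
      coeff _≟W_ (ι (n , σ)) (m , u)           ≈⟨ coeff≈linK-δ _≟W_ (ι (n , σ)) (m , u) ⟩
      _                                        ≡⟨ ∑-map _ (reducedWords σ) _ ⟩
      _                                        ≈⟨ ∑-zero (reducedWords σ) (λ w → trans (*-identityˡ _) (δW-≢ m w u n≢m)) ⟩
      0#                                       ∎

  module _ (n : ℕ) where

    open CanonicalWords n

    private
      _≟L_ : DecidableEquality Word
      _≟L_ = LP.≡-dec F._≟_
      δL : Word → Word → K
      δL = δ _≟L_

    𝟙-R-reduced : ∀ w → Reduced w → 𝟙-R (permOf w) w ≈ 1#
    𝟙-R-reduced w reduced = 𝟙-yes (isReducedWordOf? (permOf w) w)
      ((λ x → P.sym (permOf-wordPerm w x)) , P.sym (P.trans (inv-permOf w) reduced))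

    -- Among the words u of a given length and action, only u = canon u′ is counted.
    𝟙-R-canonical : (u u′ : Word) → Reduced u →
      𝟙 (does (u ≟L canon u)) * 𝟙-R (permOf u) u′ ≈ δL u (canon u′) * 𝟙-R (permOf u′) u′
    𝟙-R-canonical u u′ u-reduced with u ≟L canon u
    ... | no u≢canon = trans (zeroˡ _) (sym (trans (*-congʳ (δ-≢ _≟L_ u≢canon′)) (zeroˡ _)))
      where
      u≢canon′ : u ≢ canon u′
      u≢canon′ u≡ = u≢canon (P.sym (P.trans (P.cong canon u≡) (P.trans (canon-idem u′) (P.sym u≡))))
    ... | yes u≡canon with isReducedWordOf? (permOf u) u′
    ...   | yes u′∈R = trans (*-cong refl (𝟙-yes (isReducedWordOf? (permOf u) u′) u′∈R))
                                 (trans (*-identityˡ _) (sym (trans (*-cong (δ-≡ canon-u′≡u) (𝟙-R-reduced u′ u′-reduced)) (*-identityˡ _))))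
      where
      act = proj₁ u′∈R
      len = proj₂ u′∈R
      |u′|≡|u| : length u′ ≡ length u
      |u′|≡|u| = P.trans len (P.trans (inv-permOf u) u-reduced)
      u′~u : SameAction u′ u
      u′~u x = P.trans (act x) (permOf-wordPerm u x)
      canon-u′≡u : u ≡ canon u′
      canon-u′≡u = P.trans u≡canon (P.sym (canon-cong u′ u |u′|≡|u| u′~u))
      u′-reduced : Reduced u′
      u′-reduced = P.trans (inversions-cong u′~u) (P.trans u-reduced (P.sym |u′|≡|u|))
      δ-≡ : ∀ {v} → u ≡ v → δL u v ≈ 1#
      δ-≡ P.refl = δ-refl _≟L_ u
    ...   | no ¬u′∈R = trans (*-congˡ (𝟙-no (isReducedWordOf? (permOf u) u′) ¬u′∈R))
                                 (trans (zeroʳ _) (sym (trans (*-congʳ (δ-≢ _≟L_ u≢canon′)) (zeroˡ _))))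
      where
      u≢canon′ : u ≢ canon u′
      u≢canon′ u≡ = ¬u′∈R ((λ x → P.trans (P.sym (canon-action u′ x)) (P.trans (P.cong (λ z → wordPerm z x) (P.sym u≡))
                                  (P.sym (permOf-wordPerm u x))))
                          , P.trans (P.sym (canon-length u′)) (P.trans (P.cong length (P.sym u≡)) (P.sym (P.trans (inv-permOf u) u-reduced))))

    𝟙-R-factors : (π : Permutation′ (suc n)) (u′ v′ : Word) →
      (𝟙-R (permOf u′) u′ * 𝟙-R (permOf v′) v′) * 𝟙-R π (u′ ++ v′) ≈ 𝟙-R π (u′ ++ v′)
    𝟙-R-factors π u′ v′ with isReducedWordOf? π (u′ ++ v′)
    ... | yes u′v′∈R = begin
      (𝟙-R (permOf u′) u′ * 𝟙-R (permOf v′) v′) * 𝟙-R π (u′ ++ v′)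
        ≈⟨ *-congʳ (*-cong (𝟙-R-reduced u′ (proj₁ factors)) (𝟙-R-reduced v′ (proj₂ factors))) ⟩
      (1# * 1#) * 𝟙-R π (u′ ++ v′)  ≈⟨ trans (*-congʳ (*-identityˡ _)) (*-identityˡ _) ⟩
      𝟙-R π (u′ ++ v′)              ∎
      where factors = reduced-++⁻ u′ v′ (reducedWordOf⇒reduced π (u′ ++ v′) u′v′∈R)
    ... | no u′v′∉R = trans (*-congˡ (𝟙-no (isReducedWordOf? π (u′ ++ v′)) u′v′∉R))
                        (trans (zeroʳ _) (sym (𝟙-no (isReducedWordOf? π (u′ ++ v′)) u′v′∉R)))

    𝟙-R-canon : (π : Permutation′ (suc n)) (u′ v′ : Word) → 𝟙-R π (canon u′ ++ canon v′) ≈ 𝟙-R π (u′ ++ v′)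
    𝟙-R-canon π u′ v′ = 𝟙-R-resp π {canon u′ ++ canon v′} {u′ ++ v′}
      (P.trans (LP.length-++ (canon u′)) (P.trans (P.cong₂ ℕ._+_ (canon-length u′) (canon-length v′)) (P.sym (LP.length-++ u′))))
      (λ x → P.trans (wordPerm-++ (canon u′) (canon v′) x) (P.trans (P.cong (wordPerm (canon u′)) (canon-action v′ x))
        (P.trans (canon-action u′ (wordPerm v′ x)) (P.sym (wordPerm-++ u′ v′ x)))))

    bothCanonical : Word × Word → K
    bothCanonical (u , v) = 𝟙 (does (u ≟L canon u)) * 𝟙 (does (v ≟L canon v))

    -- Δ[π] written in the basis [σ] ⊗ [τ] of Π ⊗ Π: each factorisation π = στ with ℓ(σ) + ℓ(τ) = ℓ(π)
    -- is recorded once, at the deconcatenations of reduced words of π into canonical words.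
    ΔΠ : Permutation′ (suc n) → FV (BΠ × BΠ)
    ΔΠ π = concatMap (λ w → map (λ uv → (bothCanonical uv , ((n , permOf (proj₁ uv)) , (n , permOf (proj₂ uv)))))
                                  (deconcatenations w)) (reducedWords π)

    ∑-ΔΠ-𝟙-R : (π : Permutation′ (suc n)) (u′ v′ : Word) →
      ∑ (reducedWords π) (λ w → ∑ (deconcatenations w) (λ uv →
        bothCanonical uv * (𝟙-R (permOf (proj₁ uv)) u′ * 𝟙-R (permOf (proj₂ uv)) v′)))
      ≈ 𝟙-R π (u′ ++ v′)
    ∑-ΔΠ-𝟙-R π u′ v′ = begin
      ∑ R (λ w → ∑ (deconcatenations w) (λ uv → bothCanonical uv * (𝟙-R (permOf (proj₁ uv)) u′ * 𝟙-R (permOf (proj₂ uv)) v′)))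
        ≈⟨ ∑-congᴬ R (reducedWords-sound π) (λ w w∈R → ∑-congᴬ (deconcatenations w) (deconcatenations-++ w)
             (λ uv u++v≡w → canonical-pair uv (P.subst Reduced (P.sym u++v≡w) (reducedWordOf⇒reduced π w w∈R)))) ⟩
      ∑ R (λ w → ∑ (deconcatenations w) (λ uv → (δL (proj₁ uv) (canon u′) * δL (proj₂ uv) (canon v′)) * 𝟙u′v′))
        ≈⟨ ∑-cong R (λ w → trans (sym (*-distribʳ-∑ 𝟙u′v′ (deconcatenations w) _))
             (*-congʳ (∑-deconcatenations-δ F._≟_ w (canon u′) (canon v′)))) ⟩
      ∑ R (λ w → δL w (canon u′ ++ canon v′) * 𝟙u′v′)  ≈⟨ sym (*-distribʳ-∑ 𝟙u′v′ R _) ⟩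
      ∑ R (λ w → δL w (canon u′ ++ canon v′)) * 𝟙u′v′  ≈⟨ *-congʳ (trans (∑-reducedWords-δ π _) (𝟙-R-canon π u′ v′)) ⟩
      𝟙-R π (u′ ++ v′) * 𝟙u′v′                         ≈⟨ trans (*-comm _ _) (𝟙-R-factors π u′ v′) ⟩
      𝟙-R π (u′ ++ v′)                                 ∎
      where
      R = reducedWords π
      𝟙u′v′ : K
      𝟙u′v′ = 𝟙-R (permOf u′) u′ * 𝟙-R (permOf v′) v′
      canonical-pair : (uv : Word × Word) → Reduced (proj₁ uv ++ proj₂ uv) →
        bothCanonical uv * (𝟙-R (permOf (proj₁ uv)) u′ * 𝟙-R (permOf (proj₂ uv)) v′)
          ≈ (δL (proj₁ uv) (canon u′) * δL (proj₂ uv) (canon v′)) * 𝟙u′v′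
      canonical-pair (u , v) uv-reduced = begin
        bothCanonical (u , v) * (𝟙-R (permOf u) u′ * 𝟙-R (permOf v) v′)
          ≈⟨ *-interchange _ _ _ _ ⟩
        (𝟙 (does (u ≟L canon u)) * 𝟙-R (permOf u) u′) * (𝟙 (does (v ≟L canon v)) * 𝟙-R (permOf v) v′)
          ≈⟨ *-cong (𝟙-R-canonical u u′ (proj₁ factors)) (𝟙-R-canonical v v′ (proj₂ factors)) ⟩
        (δL u (canon u′) * 𝟙-R (permOf u′) u′) * (δL v (canon v′) * 𝟙-R (permOf v′) v′)
          ≈⟨ *-interchange _ _ _ _ ⟩
        (δL u (canon u′) * δL v (canon v′)) * 𝟙u′v′ ∎
        where factors = reduced-++⁻ u v uv-reduced

    ΔΠ-correct : (π : Permutation′ (suc n)) → tens ι ι (ΔΠ π) ≈WW lin ΔW (ι (n , π))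
    ΔΠ-correct π ((m₁ , u′) , (m₂ , v′)) = begin
      coeff _≟WW_ (tens ι ι (ΔΠ π)) ((m₁ , u′) , (m₂ , v′))
        ≈⟨ coeff-tens _≟W_ _≟W_ ι ι (ΔΠ π) (m₁ , u′) (m₂ , v′) ⟩
      linK (λ στ → coeff _≟W_ (ι (proj₁ στ)) (m₁ , u′) * coeff _≟W_ (ι (proj₂ στ)) (m₂ , v′)) (ΔΠ π)
        ≈⟨ trans (∑-concatMap _ R _) (∑-cong R (λ w → reflexive (∑-map _ (deconcatenations w) _))) ⟩
      ∑ R (λ w → ∑ (deconcatenations w) (λ uv → bothCanonical uv *
        (coeff _≟W_ (ι (n , permOf (proj₁ uv))) (m₁ , u′) * coeff _≟W_ (ι (n , permOf (proj₂ uv))) (m₂ , v′))))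
        ≈⟨ agree m₁ u′ m₂ v′ (n ℕ.≟ m₁) (n ℕ.≟ m₂) ⟩
      ∑ R (λ w → 1# * ∑ (deconcatenations w) (λ uv → δ _≟W_ (n , proj₁ uv) (m₁ , u′) * δ _≟W_ (n , proj₂ uv) (m₂ , v′)))
        ≈⟨ sym (∑-cong R (λ w → *-congˡ (coeff-ΔW w))) ⟩
      ∑ R (λ w → 1# * coeff _≟WW_ (ΔW (n , w)) ((m₁ , u′) , (m₂ , v′)))
        ≡⟨ P.sym (∑-map _ R _) ⟩
      linK (λ b → coeff _≟WW_ (ΔW b) ((m₁ , u′) , (m₂ , v′))) (ι (n , π))
        ≈⟨ sym (coeff-lin _≟WW_ ΔW (ι (n , π)) _) ⟩
      coeff _≟WW_ (lin ΔW (ι (n , π))) ((m₁ , u′) , (m₂ , v′)) ∎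
      where
      _≟WW_ = PP.≡-dec _≟W_ _≟W_
      R = reducedWords π

      coeff-ΔW : ∀ w → coeff _≟WW_ (ΔW (n , w)) ((m₁ , u′) , (m₂ , v′))
        ≈ ∑ (deconcatenations w) (λ uv → δ _≟W_ (n , proj₁ uv) (m₁ , u′) * δ _≟W_ (n , proj₂ uv) (m₂ , v′))
      coeff-ΔW w = trans (coeff≈linK-δ _≟WW_ (ΔW (n , w)) _) (trans (linK-ΔW _ n w)
        (∑-cong (deconcatenations w) (λ uv → δ-× _≟W_ _≟W_ (n , proj₁ uv) (m₁ , u′) (n , proj₂ uv) (m₂ , v′))))

      agree : (m₁ : ℕ) (u′ : List (Fin m₁)) (m₂ : ℕ) (v′ : List (Fin m₂)) → Dec (n ≡ m₁) → Dec (n ≡ m₂) →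
        ∑ R (λ w → ∑ (deconcatenations w) (λ uv → bothCanonical uv *
          (coeff _≟W_ (ι (n , permOf (proj₁ uv))) (m₁ , u′) * coeff _≟W_ (ι (n , permOf (proj₂ uv))) (m₂ , v′))))
        ≈ ∑ R (λ w → 1# * ∑ (deconcatenations w) (λ uv → δ _≟W_ (n , proj₁ uv) (m₁ , u′) * δ _≟W_ (n , proj₂ uv) (m₂ , v′)))
      agree m₁ u′ m₂ v′ (no n≢m₁) _ = trans
        (∑-zero R (λ w → ∑-zero (deconcatenations w) (λ uv →
          trans (*-congˡ (trans (*-congʳ (coeff-ι-≢ (permOf (proj₁ uv)) m₁ u′ n≢m₁)) (zeroˡ _))) (zeroʳ _))))
        (sym (∑-zero R (λ w → trans (*-congˡ (∑-zero (deconcatenations w) (λ uv →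
          trans (*-congʳ (δW-≢ m₁ (proj₁ uv) u′ n≢m₁)) (zeroˡ _)))) (zeroʳ _))))
      agree m₁ u′ m₂ v′ (yes _) (no n≢m₂) = trans
        (∑-zero R (λ w → ∑-zero (deconcatenations w) (λ uv →
          trans (*-congˡ (trans (*-congˡ (coeff-ι-≢ (permOf (proj₂ uv)) m₂ v′ n≢m₂)) (zeroʳ _))) (zeroʳ _))))
        (sym (∑-zero R (λ w → trans (*-congˡ (∑-zero (deconcatenations w) (λ uv →
          trans (*-congˡ (δW-≢ m₂ (proj₂ uv) v′ n≢m₂)) (zeroʳ _)))) (zeroʳ _))))
      agree .n u′ .n v′ (yes P.refl) (yes P.refl) = begin
        _ ≈⟨ ∑-cong R (λ w → ∑-cong (deconcatenations w) (λ uv →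
               *-congˡ (*-cong (coeff-ι (permOf (proj₁ uv)) u′) (coeff-ι (permOf (proj₂ uv)) v′)))) ⟩
        _ ≈⟨ ∑-ΔΠ-𝟙-R π u′ v′ ⟩
        𝟙-R π (u′ ++ v′)              ≈⟨ sym (∑-reducedWords-δ π (u′ ++ v′)) ⟩
        ∑ R (λ w → δL w (u′ ++ v′))
          ≈⟨ sym (∑-cong R (λ w → trans (*-identityˡ _) (trans (∑-cong (deconcatenations w) (λ uv →
               *-cong (δW-same (proj₁ uv) u′) (δW-same (proj₂ uv) v′))) (∑-deconcatenations-δ F._≟_ w u′ v′)))) ⟩
        _ ∎

  -- The morphism Ψ

  module _ (ζ : BW → K) where

    zetaA-cons : ∀ a α n w → suc a ℕ.≤ length w →
      zetaA ζ (a ∷ α) (n , w) ≡ ζ (n , take (suc a) w) * zetaA ζ α (n , drop (suc a) w)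
    zetaA-cons a α n w a<|w| with suc a ≤ᵇ length w | NP.≤⇒≤ᵇ a<|w|
    ... | true | _ = P.refl

    zetaA-cons-short : ∀ a α n w → ¬ suc a ℕ.≤ length w → zetaA ζ (a ∷ α) (n , w) ≡ 0#
    zetaA-cons-short a α n w a≮|w| with suc a ≤ᵇ length w in eq
    ... | true  = ⊥-elim (a≮|w| (NP.≤ᵇ⇒≤ (suc a) (length w) (P.subst T (P.sym eq) _)))
    ... | false = P.refl

    zetaA-graded : ∀ γ n w → ¬ ∣ γ ∣c ≡ length w → zetaA ζ γ (n , w) ≈ 0#
    zetaA-graded []      n []      |γ|≢|w| = ⊥-elim (|γ|≢|w| P.refl)
    zetaA-graded []      n (_ ∷ _) |γ|≢|w| = refl
    zetaA-graded (a ∷ γ) n w       |γ|≢|w| with suc a ℕ.≤? length w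
    ... | yes a<|w| = trans (reflexive (zetaA-cons a γ n w a<|w|)) (trans (*-congˡ (zetaA-graded γ n (drop (suc a) w) rest)) (zeroʳ _))
      where
      rest : ¬ ∣ γ ∣c ≡ length (drop (suc a) w)
      rest |γ|≡ = |γ|≢|w| (P.trans (P.cong (suc a ℕ.+_) (P.trans |γ|≡ (LP.length-drop (suc a) w))) (NP.m+[n∸m]≡n a<|w|))
    ... | no a≮|w| = reflexive (zetaA-cons-short a γ n w a≮|w|)

    zetaA-++ : ∀ β γ n (w : List (Fin n)) →
      ∑ (deconcatenations w) (λ st → zetaA ζ β (n , proj₁ st) * zetaA ζ γ (n , proj₂ st)) ≈ zetaA ζ (β ++ γ) (n , w)
    zetaA-++ []      γ n []      = trans (+-identityʳ _) (*-identityˡ _)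
    zetaA-++ []      γ n (x ∷ w) = begin
      1# * zetaA ζ γ (n , x ∷ w) + ∑ (map _ (deconcatenations w)) _
        ≈⟨ +-cong (*-identityˡ _) (reflexive (∑-map _ (deconcatenations w) _)) ⟩
      zetaA ζ γ (n , x ∷ w) + ∑ (deconcatenations w) (λ st → 0# * zetaA ζ γ (n , proj₂ st))
        ≈⟨ +-congˡ (∑-zero (deconcatenations w) (λ st → zeroˡ _)) ⟩
      zetaA ζ γ (n , x ∷ w) + 0#
        ≈⟨ +-identityʳ _ ⟩
      zetaA ζ γ (n , x ∷ w) ∎
    zetaA-++ (a ∷ β) γ n w = begin
      ∑ (deconcatenations w) (λ st → zetaA ζ (a ∷ β) (n , proj₁ st) * zetaA ζ γ (n , proj₂ st))
        ≈⟨ ∑-cong (deconcatenations w) (λ st → if-*ʳ (suc a ≤ᵇ length (proj₁ st)) _ _) ⟩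
      ∑ (deconcatenations w) (λ st → if suc a ≤ᵇ length (proj₁ st)
          then (ζ (n , take (suc a) (proj₁ st)) * zetaA ζ β (n , drop (suc a) (proj₁ st))) * zetaA ζ γ (n , proj₂ st) else 0#)
        ≈⟨ ∑-deconcatenations-drop (suc a) w (λ p s t → (ζ (n , p) * zetaA ζ β (n , s)) * zetaA ζ γ (n , t)) ⟩
      (if suc a ≤ᵇ length w
        then ∑ (deconcatenations (drop (suc a) w)) (λ st → (ζ (n , take (suc a) w) * zetaA ζ β (n , proj₁ st)) * zetaA ζ γ (n , proj₂ st))
        else 0#)
        ≈⟨ if-cong (suc a ≤ᵇ length w) (begin
            _ ≈⟨ ∑-cong (deconcatenations (drop (suc a) w)) (λ st → *-assoc _ _ _) ⟩
            _ ≈⟨ sym (*-distribˡ-∑ _ (deconcatenations (drop (suc a) w)) _) ⟩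
            _ ≈⟨ *-congˡ (zetaA-++ β γ n (drop (suc a) w)) ⟩
            _ ∎) ⟩
      zetaA ζ (a ∷ β ++ γ) (n , w) ∎

    coeff-Ψ : ∀ b γ → coeff _≟C_ (Ψ ζ b) γ ≈ zetaA ζ γ b
    coeff-Ψ (n , w) γ = begin
      coeff _≟C_ (Ψ ζ (n , w)) γ                                  ≈⟨ coeff≈linK-δ _≟C_ (Ψ ζ (n , w)) γ ⟩
      _                                                           ≡⟨ ∑-map _ (comps (length w)) _ ⟩
      ∑ (comps (length w)) (λ α → zetaA ζ α (n , w) * δC α γ)     ≈⟨ ∑-comps-δ (length w) _ γ ⟩
      𝟙≡ ∣ γ ∣c (length w) * zetaA ζ γ (n , w)                     ≈⟨ degree-match ⟩
      zetaA ζ γ (n , w)                                           ∎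
      where
      degree-match : 𝟙≡ ∣ γ ∣c (length w) * zetaA ζ γ (n , w) ≈ zetaA ζ γ (n , w)
      degree-match with ∣ γ ∣c ℕ.≟ length w
      ... | yes |γ|≡|w| = trans (*-congʳ (𝟙-yes (∣ γ ∣c ℕ.≟ length w) |γ|≡|w|)) (*-identityˡ _)
      ... | no |γ|≢|w|  = trans (*-congʳ (𝟙-no (∣ γ ∣c ℕ.≟ length w) |γ|≢|w|))
                            (trans (zeroˡ _) (sym (zetaA-graded γ n w |γ|≢|w|)))

    Ψ-homogeneous : ∀ b → Homogeneous (degW b) (Ψ ζ b)
    Ψ-homogeneous (n , w) α |α|≢|w| = trans (coeff-Ψ (n , w) α) (zetaA-graded α n w |α|≢|w|)



    zetaA-ΔW : ∀ β γ b → linK (λ bb → zetaA ζ β (proj₁ bb) * zetaA ζ γ (proj₂ bb)) (ΔW b) ≈ zetaA ζ (β ++ γ) b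
    zetaA-ΔW β γ (n , w) = trans (linK-ΔW _ n w) (zetaA-++ β γ n w)

    Ψ-comult : ∀ b → tens (Ψ ζ) (Ψ ζ) (ΔW b) ≈QQ lin ΔQ (Ψ ζ b)
    Ψ-comult b (β , γ) = begin
      coeff (PP.≡-dec _≟C_ _≟C_) (tens (Ψ ζ) (Ψ ζ) (ΔW b)) (β , γ)
        ≈⟨ coeff-tens _≟C_ _≟C_ (Ψ ζ) (Ψ ζ) (ΔW b) β γ ⟩
      linK (λ bb → coeff _≟C_ (Ψ ζ (proj₁ bb)) β * coeff _≟C_ (Ψ ζ (proj₂ bb)) γ) (ΔW b)
        ≈⟨ linK-cong (ΔW b) (λ bb → *-cong (coeff-Ψ (proj₁ bb) β) (coeff-Ψ (proj₂ bb) γ)) ⟩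
      linK (λ bb → zetaA ζ β (proj₁ bb) * zetaA ζ γ (proj₂ bb)) (ΔW b)
        ≈⟨ zetaA-ΔW β γ b ⟩
      zetaA ζ (β ++ γ) b                                        ≈⟨ sym (coeff-Ψ b (β ++ γ)) ⟩
      coeff _≟C_ (Ψ ζ b) (β ++ γ)                               ≈⟨ sym (coeff-lin-ΔQ (Ψ ζ b) β γ) ⟩
      coeff (PP.≡-dec _≟C_ _≟C_) (lin ΔQ (Ψ ζ b)) (β , γ)       ∎

    Ψ-counit : ∀ b → linK εQ (Ψ ζ b) ≈ εW b
    Ψ-counit b = trans (linK-εQ (Ψ ζ b)) (coeff-Ψ b [])

    Ψ-unit : lin (Ψ ζ) unitW ≈Q unitQ
    Ψ-unit γ = begin
      coeff _≟C_ (lin (Ψ ζ) unitW) γ              ≈⟨ coeff-lin _≟C_ (Ψ ζ) unitW γ ⟩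
      1# * coeff _≟C_ (Ψ ζ (0 , [])) γ + 0#       ≈⟨ trans (+-identityʳ _) (*-identityˡ _) ⟩
      coeff _≟C_ (Ψ ζ (0 , [])) γ                 ≈⟨ coeff-Ψ (0 , []) γ ⟩
      zetaA ζ γ (0 , [])                          ≈⟨ unit-coeff γ ⟩
      coeff _≟C_ unitQ γ                          ∎
      where
      unit-coeff : ∀ γ → zetaA ζ γ (0 , []) ≈ coeff _≟C_ unitQ γ
      unit-coeff []      = sym (+-identityʳ _)
      unit-coeff (_ ∷ _) = sym (+-identityʳ _)


    linK-ι-cong : ∀ p {g h : BW → K} → (∀ w → length w ≡ degΠ p → g (proj₁ p , w) ≈ h (proj₁ p , w)) →
      linK g (ι p) ≈ linK h (ι p)
    linK-ι-cong (n , π) g≈h = begin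
      _ ≡⟨ ∑-map _ (reducedWords π) _ ⟩
      _ ≈⟨ ∑-congᴬ (reducedWords π) (reducedWords-sound π) (λ w w∈R → *-congˡ (g≈h w (proj₂ w∈R))) ⟩
      _ ≡⟨ P.sym (∑-map _ (reducedWords π) _) ⟩
      _ ∎

    coeff-Ψres : ∀ p γ → coeff _≟C_ (Ψres ζ p) γ ≈ linK (zetaA ζ γ) (ι p)
    coeff-Ψres p γ = trans (coeff-lin _≟C_ (Ψ ζ) (ι p) γ) (linK-cong (ι p) (λ b → coeff-Ψ b γ))

    zetaA-ι-graded : ∀ α p → ¬ ∣ α ∣c ≡ degΠ p → linK (zetaA ζ α) (ι p) ≈ 0#
    zetaA-ι-graded α p |α|≢ = trans (linK-ι-cong p (λ w |w|≡ → zetaA-graded α (proj₁ p) w (λ |α|≡ → |α|≢ (P.trans |α|≡ |w|≡))))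
                                     (∑-zero (ι p) (λ _ → zeroʳ _))

    zetaA-ι-comult : ∀ p (y : FV (BΠ × BΠ)) → tens ι ι y ≈WW lin ΔW (ι p) → ∀ β γ →
      linK (λ στ → linK (zetaA ζ β) (ι (proj₁ στ)) * linK (zetaA ζ γ) (ι (proj₂ στ))) y ≈ linK (zetaA ζ (β ++ γ)) (ι p)
    zetaA-ι-comult p y y≈Δp β γ = begin
      linK (λ στ → linK (zetaA ζ β) (ι (proj₁ στ)) * linK (zetaA ζ γ) (ι (proj₂ στ))) y
        ≈⟨ linK-cong y (λ στ → sym (linK-* (ι (proj₁ στ)) (ι (proj₂ στ)) (zetaA ζ β) (zetaA ζ γ))) ⟩
      _ ≈⟨ sym (linK-tens ι ι y Zβ⊗Zγ) ⟩
      linK Zβ⊗Zγ (tens ι ι y)       ≈⟨ linK-resp (PP.≡-dec _≟W_ _≟W_) Zβ⊗Zγ (tens ι ι y) (lin ΔW (ι p)) y≈Δp ⟩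
      linK Zβ⊗Zγ (lin ΔW (ι p))     ≈⟨ linK-lin ΔW (ι p) _ ⟩
      _ ≈⟨ linK-cong (ι p) (zetaA-ΔW β γ) ⟩
      linK (zetaA ζ (β ++ γ)) (ι p) ∎
      where
      Zβ⊗Zγ : BW × BW → K
      Zβ⊗Zγ bb = zetaA ζ β (proj₁ bb) * zetaA ζ γ (proj₂ bb)

    Ψres-homogeneous : ∀ p → Homogeneous (degΠ p) (Ψres ζ p)
    Ψres-homogeneous p α |α|≢ = trans (coeff-Ψres p α) (zetaA-ι-graded α p |α|≢)

    Ψres-comult : ∀ p (y : FV (BΠ × BΠ)) → tens ι ι y ≈WW lin ΔW (ι p) → tens (Ψres ζ) (Ψres ζ) y ≈QQ lin ΔQ (Ψres ζ p)
    Ψres-comult p y y≈Δp (β , γ) = begin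
      coeff (PP.≡-dec _≟C_ _≟C_) (tens (Ψres ζ) (Ψres ζ) y) (β , γ)
        ≈⟨ coeff-tens _≟C_ _≟C_ (Ψres ζ) (Ψres ζ) y β γ ⟩
      _ ≈⟨ linK-cong y (λ στ → *-cong (coeff-Ψres (proj₁ στ) β) (coeff-Ψres (proj₂ στ) γ)) ⟩
      _ ≈⟨ zetaA-ι-comult p y y≈Δp β γ ⟩
      linK (zetaA ζ (β ++ γ)) (ι p)                            ≈⟨ sym (coeff-Ψres p (β ++ γ)) ⟩
      coeff _≟C_ (Ψres ζ p) (β ++ γ)                           ≈⟨ sym (coeff-lin-ΔQ (Ψres ζ p) β γ) ⟩
      coeff (PP.≡-dec _≟C_ _≟C_) (lin ΔQ (Ψres ζ p)) (β , γ)  ∎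

    Ψres-counit : ∀ p → linK εQ (Ψres ζ p) ≈ linK εW (ι p)
    Ψres-counit p = trans (linK-lin (Ψ ζ) (ι p) εQ) (linK-cong (ι p) Ψ-counit)

    coeff-lin-Ψres : ∀ (y : FV BΠ) γ → coeff _≟C_ (lin (Ψres ζ) y) γ ≈ linK (λ b → coeff _≟C_ (Ψ ζ b) γ) (lin ι y)
    coeff-lin-Ψres y γ = trans (coeff-lin _≟C_ (Ψres ζ) y γ)
      (trans (linK-cong y (λ p → coeff-lin _≟C_ (Ψ ζ) (ι p) γ)) (sym (linK-lin ι y _)))

    Ψres-unit : ∀ (y : FV BΠ) → lin ι y ≈W unitW → lin (Ψres ζ) y ≈Q unitQ
    Ψres-unit y y≈1 γ = begin
      coeff _≟C_ (lin (Ψres ζ) y) γ                    ≈⟨ coeff-lin-Ψres y γ ⟩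
      linK (λ b → coeff _≟C_ (Ψ ζ b) γ) (lin ι y)      ≈⟨ linK-resp _≟W_ _ (lin ι y) unitW y≈1 ⟩
      linK (λ b → coeff _≟C_ (Ψ ζ b) γ) unitW          ≈⟨ sym (coeff-lin _≟C_ (Ψ ζ) unitW γ) ⟩
      coeff _≟C_ (lin (Ψ ζ) unitW) γ                   ≈⟨ Ψ-unit γ ⟩
      coeff _≟C_ unitQ γ                               ∎

    module _ (ζ-empty : ∀ n → ζ (n , []) ≈ 1#) where

      zetaA-singlePart : ∀ n w → zetaA ζ (singlePart (length w)) (n , w) ≈ ζ (n , w)
      zetaA-singlePart n []      = sym (ζ-empty n)
      zetaA-singlePart n (x ∷ w) = begin
        zetaA ζ (length w ∷ []) (n , x ∷ w)                                   ≡⟨ zetaA-cons (length w) [] n (x ∷ w) NP.≤-refl ⟩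
        ζ (n , x ∷ take (length w) w) * zetaA ζ [] (n , drop (length w) w)   ≡⟨ P.cong₂ (λ u v → ζ (n , x ∷ u) * zetaA ζ [] (n , v))
                                                                                 (LP.take-all (length w) w NP.≤-refl) (LP.drop-all (length w) w NP.≤-refl) ⟩
        ζ (n , x ∷ w) * 1#                                                    ≈⟨ *-identityʳ _ ⟩
        ζ (n , x ∷ w)                                                         ∎

      Ψ-compatible : ∀ b → linK ζQ (Ψ ζ b) ≈ ζ b
      Ψ-compatible (n , w) = begin
        linK ζQ (Ψ ζ (n , w))                             ≈⟨ linK-ζQ-homogeneous (length w) (Ψ ζ (n , w)) (Ψ-homogeneous (n , w)) ⟩
        coeff _≟C_ (Ψ ζ (n , w)) (singlePart (length w))  ≈⟨ coeff-Ψ (n , w) (singlePart (length w)) ⟩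
        zetaA ζ (singlePart (length w)) (n , w)           ≈⟨ zetaA-singlePart n w ⟩
        ζ (n , w)                                         ∎

      Ψ-unique : ∀ Φ → IsCombBialgMorW ζ Φ → ∀ b → Φ b ≈Q Ψ ζ b
      Ψ-unique Φ Φ-mor b γ = trans
        (coalgebraMap-unique degW ΔW εW ζ (zetaA ζ) (λ { α (n , w) → zetaA-graded α n w }) (λ _ → refl)
           (λ { (n , w) → zetaA-singlePart n w }) (λ a β → zetaA-ΔW (a ∷ []) β)
           Φ graded comult counit compatible γ b)
        (sym (coeff-Ψ b γ))
        where open IsCombBialgMorW Φ-mor


      Ψres-compatible : ∀ p → linK ζQ (Ψres ζ p) ≈ linK ζ (ι p)
      Ψres-compatible p = trans (linK-lin (Ψ ζ) (ι p) ζQ) (linK-cong (ι p) Ψ-compatible)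

      Ψres-unique : ∀ Φ → IsCombBialgMorΠ ζ Φ → ∀ p → Φ p ≈Q Ψres ζ p
      Ψres-unique Φ Φ-mor p γ = trans
        (coalgebraMap-unique degΠ (λ p → ΔΠ (proj₁ p) (proj₂ p)) (λ p → linK εW (ι p)) (λ p → linK ζ (ι p))
           (λ α p → linK (zetaA ζ α) (ι p)) zetaA-ι-graded (λ _ → refl)
           (λ p → linK-ι-cong p (λ w |w|≡ → P.subst (λ d → zetaA ζ (singlePart d) (proj₁ p , w) ≈ ζ (proj₁ p , w)) |w|≡
                                                      (zetaA-singlePart (proj₁ p) w)))
           (λ a β p → zetaA-ι-comult p (ΔΠ (proj₁ p) (proj₂ p)) (ΔΠ-correct (proj₁ p) (proj₂ p)) (a ∷ []) β)
           Φ graded (λ p → comult p (ΔΠ (proj₁ p) (proj₂ p)) (ΔΠ-correct (proj₁ p) (proj₂ p))) counit compatible γ p)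
        (sym (coeff-Ψres p γ))
        where open IsCombBialgMorΠ Φ-mor



      module _ (ζ-mult : Multiplicative ζ) (m n : ℕ) where

        private
          liftˡ : List (Fin m) → List (Fin (m ℕ.+ n))
          liftˡ = map (_↑ˡ n)
          liftʳ : List (Fin n) → List (Fin (m ℕ.+ n))
          liftʳ = map (m ↑ʳ_)

          shuffleSum : Comp → List (Fin m) → List (Fin n) → K
          shuffleSum γ v w = ∑ (shuffles (liftˡ v) (liftʳ w)) (λ u → zetaA ζ γ (m ℕ.+ n , u))

          deshuffleSum : Comp → List (Fin m) → List (Fin n) → K
          deshuffleSum γ v w = ∑ (quasiDeshuffles γ) (λ αβ → zetaA ζ (proj₁ αβ) (m , v) * zetaA ζ (proj₂ αβ) (n , w))

          cutTerm : Comp → List (Fin m) → List (Fin n) → ℕ → ℕ → K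
          cutTerm γ v w i j = if i ≤ᵇ length v then (if j ≤ᵇ length w then
            (ζ (m , take i v) * ζ (n , take j w)) * deshuffleSum γ (drop i v) (drop j w) else 0#) else 0#

          ζ-shuffles : ∀ v w → ∑ (shuffles (liftˡ v) (liftʳ w)) (λ u → ζ (m ℕ.+ n , u)) ≈ ζ (m , v) * ζ (n , w)
          ζ-shuffles v w = trans (∑-cong (shuffles (liftˡ v) (liftʳ w)) (λ u → sym (*-identityˡ _)))
            (trans (reflexive (P.sym (∑-map _ (shuffles (liftˡ v) (liftʳ w)) _))) (ζ-mult (m , v) (n , w)))

          shuffleCut≈cutTerm : ∀ γ → (∀ v w → shuffleSum γ v w ≈ deshuffleSum γ v w) → ∀ v w i j →
            shuffleCut (λ p s → ζ (m ℕ.+ n , p) * zetaA ζ γ (m ℕ.+ n , s)) (liftˡ v) (liftʳ w) i j ≈ cutTerm γ v w i j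
          shuffleCut≈cutTerm γ shuffle≈deshuffle v w i j =
            if-if-cong (P.cong (i ≤ᵇ_) (LP.length-map _ v)) (P.cong (j ≤ᵇ_) (LP.length-map _ w)) (begin
              ∑ (shuffles (take i (liftˡ v)) (take j (liftʳ w))) (λ p → ∑ (shuffles (drop i (liftˡ v)) (drop j (liftʳ w)))
                (λ s → ζ (m ℕ.+ n , p) * zetaA ζ γ (m ℕ.+ n , s)))
                ≈⟨ ∑-cong (shuffles (take i (liftˡ v)) (take j (liftʳ w))) (λ p → sym (*-distribˡ-∑ _ (shuffles (drop i (liftˡ v)) (drop j (liftʳ w))) _)) ⟩
              ∑ (shuffles (take i (liftˡ v)) (take j (liftʳ w))) (λ p → ζ (m ℕ.+ n , p) *
                ∑ (shuffles (drop i (liftˡ v)) (drop j (liftʳ w))) (λ s → zetaA ζ γ (m ℕ.+ n , s)))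
                ≈⟨ sym (*-distribʳ-∑ _ (shuffles (take i (liftˡ v)) (take j (liftʳ w))) _) ⟩
              ∑ (shuffles (take i (liftˡ v)) (take j (liftʳ w))) (λ p → ζ (m ℕ.+ n , p)) *
                ∑ (shuffles (drop i (liftˡ v)) (drop j (liftʳ w))) (λ s → zetaA ζ γ (m ℕ.+ n , s))
                ≡⟨ P.cong₂ _*_ (P.cong₂ (λ p q → ∑ (shuffles p q) (λ u → ζ (m ℕ.+ n , u))) (LP.take-map i v) (LP.take-map j w))
                               (P.cong₂ (λ p q → ∑ (shuffles p q) (λ u → zetaA ζ γ (m ℕ.+ n , u))) (LP.drop-map i v) (LP.drop-map j w)) ⟩
              ∑ (shuffles (liftˡ (take i v)) (liftʳ (take j w))) (λ p → ζ (m ℕ.+ n , p)) * shuffleSum γ (drop i v) (drop j w)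
                ≈⟨ *-cong (ζ-shuffles (take i v) (take j w)) (shuffle≈deshuffle (drop i v) (drop j w)) ⟩
              (ζ (m , take i v) * ζ (n , take j w)) * deshuffleSum γ (drop i v) (drop j w) ∎)

        zetaA-shuffles : ∀ γ v w → shuffleSum γ v w ≈ deshuffleSum γ v w
        zetaA-shuffles [] []      []      = +-congʳ (sym (*-identityʳ _))
        zetaA-shuffles [] []      (_ ∷ _) = +-congʳ (sym (zeroʳ _))
        zetaA-shuffles [] (_ ∷ _) []      = +-congʳ (sym (zeroˡ _))
        zetaA-shuffles [] (x ∷ v) (y ∷ w) = begin
          shuffleSum [] (x ∷ v) (y ∷ w)
            ≈⟨ ∑-++ (map ((x ↑ˡ n) ∷_) (shuffles (liftˡ v) (liftʳ (y ∷ w)))) _ _ ⟩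
          _ ≈⟨ +-cong (reflexive (∑-map _ (shuffles (liftˡ v) (liftʳ (y ∷ w))) _)) (reflexive (∑-map _ (shuffles (liftˡ (x ∷ v)) (liftʳ w)) _)) ⟩
          _ ≈⟨ +-cong (∑-zero (shuffles (liftˡ v) (liftʳ (y ∷ w))) (λ _ → refl)) (∑-zero (shuffles (liftˡ (x ∷ v)) (liftʳ w)) (λ _ → refl)) ⟩
          0# + 0# ≈⟨ +-congʳ (sym (zeroˡ _)) ⟩
          deshuffleSum [] (x ∷ v) (y ∷ w) ∎
        zetaA-shuffles (c ∷ γ) v w = begin
          shuffleSum (c ∷ γ) v w
            ≈⟨ ∑-shuffles-cut (suc c) (liftˡ v) (liftʳ w) (λ p s → ζ (m ℕ.+ n , p) * zetaA ζ γ (m ℕ.+ n , s)) ⟩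
          _ ≈⟨ ∑-cong (antidiagonal (suc c)) (λ ij → shuffleCut≈cutTerm γ (zetaA-shuffles γ) v w (proj₁ ij) (proj₂ ij)) ⟩
          ∑ (antidiagonal (suc c)) (λ ij → cutTerm γ v w (proj₁ ij) (proj₂ ij))
            ≈⟨ +-congˡ (reflexive (∑-map _ (antidiagonal c) _)) ⟩
          cutTerm γ v w 0 (suc c) + ∑ (antidiagonal c) (λ ij → cutTerm γ v w (suc (proj₁ ij)) (proj₂ ij))
            ≈⟨ +-congˡ (∑-antidiagonal-merges c (λ i j → cutTerm γ v w (suc i) j)) ⟩
          cutTerm γ v w 0 (suc c) + (∑ (merges c) (λ ij → cutTerm γ v w (suc (proj₁ ij)) (suc (proj₂ ij))) + cutTerm γ v w (suc c) 0)
            ≈⟨ trans (sym (+-assoc _ _ _)) (+-comm _ _) ⟩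
          cutTerm γ v w (suc c) 0 + (cutTerm γ v w 0 (suc c) + ∑ (merges c) (λ ij → cutTerm γ v w (suc (proj₁ ij)) (suc (proj₂ ij))))
            ≈⟨ +-cong (sym first-from-v) (+-cong (sym first-from-w) (sym merged)) ⟩
          ∑ 𝒟 T₁ + (∑ 𝒟 T₂ + ∑ 𝒟 T₃) ≈⟨ +-congˡ (sym (∑-distrib-+ 𝒟 _ _)) ⟩
          _ ≈⟨ sym (∑-distrib-+ 𝒟 _ _) ⟩
          _ ≈⟨ sym (∑-concatMap _ 𝒟 _) ⟩
          deshuffleSum (c ∷ γ) v w ∎
          where
          𝒟 = quasiDeshuffles γ
          Z : Comp × Comp → K
          Z αβ = zetaA ζ (proj₁ αβ) (m , v) * zetaA ζ (proj₂ αβ) (n , w)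
          T₁ T₂ T₃ : Comp × Comp → K
          T₁ αβ = Z (c ∷ proj₁ αβ , proj₂ αβ)
          T₂ αβ = Z (proj₁ αβ , c ∷ proj₂ αβ)
          T₃ αβ = ∑ (map (λ ij → (proj₁ ij ∷ proj₁ αβ , proj₂ ij ∷ proj₂ αβ)) (merges c)) Z
          first-from-v : ∑ 𝒟 T₁ ≈ cutTerm γ v w (suc c) 0
          first-from-v = begin
            ∑ 𝒟 T₁ ≈⟨ ∑-cong 𝒟 (λ αβ → trans (if-*ʳ _ _ _) (if-cong (suc c ≤ᵇ length v) (*-assoc _ _ _))) ⟩
            _ ≈⟨ ∑-if (suc c ≤ᵇ length v) 𝒟 _ ⟩
            _ ≈⟨ if-cong (suc c ≤ᵇ length v) (trans (sym (*-distribˡ-∑ _ 𝒟 _))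
                   (*-congʳ (trans (sym (*-identityʳ _)) (*-congˡ (sym (ζ-empty n)))))) ⟩
            cutTerm γ v w (suc c) 0 ∎
          first-from-w : ∑ 𝒟 T₂ ≈ cutTerm γ v w 0 (suc c)
          first-from-w = begin
            ∑ 𝒟 T₂ ≈⟨ ∑-cong 𝒟 (λ αβ → trans (if-*ˡ _ _ _) (if-cong (suc c ≤ᵇ length w) (*-left-comm _ _ _))) ⟩
            _ ≈⟨ ∑-if (suc c ≤ᵇ length w) 𝒟 _ ⟩
            _ ≈⟨ if-cong (suc c ≤ᵇ length w) (trans (sym (*-distribˡ-∑ _ 𝒟 _))
                   (*-congʳ (trans (sym (*-identityˡ _)) (*-congʳ (sym (ζ-empty m)))))) ⟩
            cutTerm γ v w 0 (suc c) ∎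
          merged : ∑ 𝒟 T₃ ≈ ∑ (merges c) (λ ij → cutTerm γ v w (suc (proj₁ ij)) (suc (proj₂ ij)))
          merged = begin
            ∑ 𝒟 T₃ ≈⟨ ∑-cong 𝒟 (λ αβ → reflexive (∑-map _ (merges c) _)) ⟩
            _ ≈⟨ ∑-comm 𝒟 (merges c) _ ⟩
            _ ≈⟨ ∑-cong (merges c) (λ { (i , j) → begin
                  _ ≈⟨ ∑-cong 𝒟 (λ αβ → trans (if-*-if (suc i ≤ᵇ length v) (suc j ≤ᵇ length w) _ _)
                         (if-if-cong {suc i ≤ᵇ length v} {b₂ = suc j ≤ᵇ length w} P.refl P.refl (*-interchange _ _ _ _))) ⟩
                  _ ≈⟨ ∑-if (suc i ≤ᵇ length v) 𝒟 _ ⟩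
                  _ ≈⟨ if-cong (suc i ≤ᵇ length v) (∑-if (suc j ≤ᵇ length w) 𝒟 _) ⟩
                  _ ≈⟨ if-if-cong {suc i ≤ᵇ length v} {b₂ = suc j ≤ᵇ length w} P.refl P.refl (sym (*-distribˡ-∑ _ 𝒟 _)) ⟩
                  cutTerm γ v w (suc i) (suc j) ∎ }) ⟩
            _ ∎

        Ψ-mult-coeff : ∀ v w γ → coeff _≟C_ (lin (Ψ ζ) (prodW (m , v) (n , w))) γ ≈ coeff _≟C_ (bilin prodQ (Ψ ζ (m , v)) (Ψ ζ (n , w))) γ
        Ψ-mult-coeff v w γ = begin
          coeff _≟C_ (lin (Ψ ζ) (prodW (m , v) (n , w))) γ
            ≈⟨ coeff-lin _≟C_ (Ψ ζ) (prodW (m , v) (n , w)) γ ⟩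
          _ ≈⟨ linK-cong (prodW (m , v) (n , w)) (λ b → coeff-Ψ b γ) ⟩
          _ ≡⟨ ∑-map _ (shuffles (liftˡ v) (liftʳ w)) _ ⟩
          _ ≈⟨ ∑-cong (shuffles (liftˡ v) (liftʳ w)) (λ u → *-identityˡ _) ⟩
          shuffleSum γ v w   ≈⟨ zetaA-shuffles γ v w ⟩
          deshuffleSum γ v w ≈⟨ ∑-cong (quasiDeshuffles γ) (λ αβ → sym (*-cong (coeff-Ψ (m , v) (proj₁ αβ)) (coeff-Ψ (n , w) (proj₂ αβ)))) ⟩
          _ ≈⟨ sym (coeff-bilin-prodQ (Ψ ζ (m , v)) (Ψ ζ (n , w)) γ) ⟩
          coeff _≟C_ (bilin prodQ (Ψ ζ (m , v)) (Ψ ζ (n , w))) γ ∎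

      Ψ-mult : Multiplicative ζ → ∀ b b′ → lin (Ψ ζ) (prodW b b′) ≈Q bilin prodQ (Ψ ζ b) (Ψ ζ b′)
      Ψ-mult ζ-mult (m , v) (n , w) = Ψ-mult-coeff ζ-mult m n v w


      Ψres-mult : Multiplicative ζ → ∀ p q (y : FV BΠ) → lin ι y ≈W bilin prodW (ι p) (ι q) →
        lin (Ψres ζ) y ≈Q bilin prodQ (Ψres ζ p) (Ψres ζ q)
      Ψres-mult ζ-mult p q y y≈pq γ = begin
        coeff _≟C_ (lin (Ψres ζ) y) γ
          ≈⟨ coeff-lin-Ψres y γ ⟩
        _ ≈⟨ linK-resp _≟W_ _ (lin ι y) (bilin prodW (ι p) (ι q)) y≈pq ⟩
        _ ≈⟨ linK-bilin prodW (ι p) (ι q) _ ⟩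
        linK (λ b → linK (λ b′ → linK (λ b″ → coeff _≟C_ (Ψ ζ b″) γ) (prodW b b′)) (ι q)) (ι p)
          ≈⟨ linK-cong (ι p) (λ b → linK-cong (ι q) (λ b′ → begin
               _ ≈⟨ sym (coeff-lin _≟C_ (Ψ ζ) (prodW b b′) γ) ⟩
               _ ≈⟨ Ψ-mult ζ-mult b b′ γ ⟩
               _ ≈⟨ coeff≈linK-δ _≟C_ (bilin prodQ (Ψ ζ b) (Ψ ζ b′)) γ ⟩
               _ ≈⟨ linK-bilin prodQ (Ψ ζ b) (Ψ ζ b′) _ ⟩
               linK (λ α → linK (N α) (Ψ ζ b′)) (Ψ ζ b) ∎)) ⟩
        linK (λ b → linK (λ b′ → linK (λ α → linK (N α) (Ψ ζ b′)) (Ψ ζ b)) (ι q)) (ι p)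
          ≈⟨ linK-cong (ι p) (λ b → sym (linK-comm (Ψ ζ b) (ι q) _)) ⟩
        linK (λ b → linK (λ α → linK (λ b′ → linK (N α) (Ψ ζ b′)) (ι q)) (Ψ ζ b)) (ι p)
          ≈⟨ linK-cong (ι p) (λ b → linK-cong (Ψ ζ b) (λ α → sym (linK-lin (Ψ ζ) (ι q) _))) ⟩
        linK (λ b → linK (λ α → linK (N α) (Ψres ζ q)) (Ψ ζ b)) (ι p)
          ≈⟨ sym (linK-lin (Ψ ζ) (ι p) _) ⟩
        linK (λ α → linK (N α) (Ψres ζ q)) (Ψres ζ p)
          ≈⟨ sym (linK-bilin prodQ (Ψres ζ p) (Ψres ζ q) _) ⟩
        _ ≈⟨ sym (coeff≈linK-δ _≟C_ (bilin prodQ (Ψres ζ p) (Ψres ζ q)) γ) ⟩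
        coeff _≟C_ (bilin prodQ (Ψres ζ p) (Ψres ζ q)) γ ∎
        where
        N : Comp → Comp → K
        N α β = linK (λ γ′ → δC γ′ γ) (prodQ α β)

theorem5p2 : ∀ {c ℓ} (𝕜 : Field c ℓ) → let open WithField 𝕜 in
    (ζ : BW → K) →
    (∀ n → ζ (n , []) ≈ 1#) →
    Multiplicative ζ →
    (IsCombBialgMorW ζ (Ψ ζ)
    × (∀ Φ → IsCombBialgMorW ζ Φ → ∀ b → Φ b ≈Q Ψ ζ b))
    × (IsCombBialgMorΠ ζ (Ψres ζ)
    × (∀ Φ → IsCombBialgMorΠ ζ Φ → ∀ p → Φ p ≈Q Ψres ζ p))
theorem5p2 𝕜 ζ ζ-empty ζ-mult =
  ( record { graded = Ψ-homogeneous 𝕜 ζ ; comult = Ψ-comult 𝕜 ζ ; counit = Ψ-counit 𝕜 ζ ; unit = Ψ-unit 𝕜 ζ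
           ; mult = Ψ-mult 𝕜 ζ ζ-empty ζ-mult ; compatible = Ψ-compatible 𝕜 ζ ζ-empty }
  , Ψ-unique 𝕜 ζ ζ-empty )
  , ( record { graded = Ψres-homogeneous 𝕜 ζ ; comult = Ψres-comult 𝕜 ζ ; counit = Ψres-counit 𝕜 ζ
             ; unit = Ψres-unit 𝕜 ζ ; mult = Ψres-mult 𝕜 ζ ζ-empty ζ-mult ; compatible = Ψres-compatible 𝕜 ζ ζ-empty }
    , Ψres-unique 𝕜 ζ ζ-empty )
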